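{- Let $\Theta_1$ and $\Theta_2$ be closed IIMLL proof nets with the same conclusion and with an order less than 4 such that $\Theta_1 \neq \Theta_2$. Then there is a one-hole context $C[]$ such that $C[\Theta_1[p \multimap (p \multimap p) \multimap (p \multimap p) \multimap p/p]] = \underline{0}$ and $C[\Theta_2[p \multimap (p \multimap p) \multimap (p \multimap p) \multimap p/p]] = \underline{1}$.
   Context: IMLL formulas are built from one atom $p$ with $\otimes$ and $⅋$ (par), with polarities; $(A\otimes B)^-$ and $(A⅋B)^+$ are written as linear implications $A \multimap B$. IIMLL proof nets are IMLL proof nets built without $\otimes^+$- and $⅋^-$-links (the purely implicational fragment). Nets are identified with their normal forms (cut elimination plus multiplicative $\eta$-expansion); closed means exactly one conclusion. The order of a formula is defined by $\mathrm{order}(p)=1$ and $\mathrm{order}(A_1 \multimap \cdots \multimap A_n \multimap p) = \max_i \mathrm{order}(A_i) + 1$; the order of a closed net is the order of its conclusion. Equality $=$ of normal nets is the paper's equality via main paths, heads and direct subproof nets (corresponding to $\beta\eta$-equality of linear $\lambda$-terms up to renaming of free variables). A one-hole context $C[]$ is an extended IIMLL proof net with exactly one hole axiom; $C[\Theta]$ plugs $\Theta$ into it. $\Theta[A/p]$ replaces every occurrence of $p$ by $A$. $\underline{0}$ and $\underline{1}$ are the two closed normal nets of $p \multimap (p \multimap p) \multimap (p \multimap p) \multimap p$, corresponding to $\lambda x.\lambda f.\lambda g.\, g(f x)$ and $\lambda x.\lambda f.\lambda g.\, f(g x)$. -}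

module Defs where

-- IIMLL proof nets (purely implicational fragment, single atom p) are
-- represented, as in the paper, by linear lambda-terms (de Bruijn indices,
-- Church-style type annotations on binders).  Equality of nets (normal forms
-- via main paths/heads/direct subproof nets) is beta-eta equality of these
-- linear terms, given here as the typed beta-eta conversion judgement.

open import Data.Nat using (ℕ; zero; suc; _+_; _⊔_; _<_; compare; less; equal; greater)
open import Data.List using (List; []; _∷_)
open import Data.Maybe using (Maybe; just; nothing)
open import Data.Product using (_×_)
open import Data.Unit using (⊤)
open import Relation.Binary.PropositionalEquality using (_≡_)

infixr 20 _⊸_
data Ty : Set where
  p   : Ty
  _⊸_ : Ty → Ty → Ty

-- order(p) = 1, order(A1 ⊸ ... ⊸ An ⊸ p) = max_i order(Ai) + 1
order : Ty → ℕ
order p       = 1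
order (A ⊸ B) = suc (order A) ⊔ order B

_[_/p] : Ty → Ty → Ty
p [ σ /p]       = σ
(A ⊸ B) [ σ /p] = (A [ σ /p]) ⊸ (B [ σ /p])

data Tm : Set where
  var  : ℕ → Tm
  lam  : Ty → Tm → Tm
  app  : Tm → Tm → Tm
  hole : Tm

_⟦_/p⟧ : Tm → Ty → Tm
var i     ⟦ σ /p⟧ = var i
lam A t   ⟦ σ /p⟧ = lam (A [ σ /p]) (t ⟦ σ /p⟧)
app t u   ⟦ σ /p⟧ = app (t ⟦ σ /p⟧) (u ⟦ σ /p⟧)
hole      ⟦ σ /p⟧ = hole

occ : ℕ → Tm → ℕ
occ i (var j) with compare i j
... | equal _ = 1
... | less _ _ = 0
... | greater _ _ = 0
occ i (lam A t) = occ (suc i) t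
occ i (app t u) = occ i t + occ i u
occ i hole      = 0

holes : Tm → ℕ
holes (var _)   = 0
holes (lam _ t) = holes t
holes (app t u) = holes t + holes u
holes hole      = 1

Linear : Tm → Set
Linear (var _)   = ⊤
Linear (lam _ t) = occ 0 t ≡ 1 × Linear t
Linear (app t u) = Linear t × Linear u
Linear hole      = ⊤

plug : Tm → Tm → Tm
plug (var i)   Θ = var i
plug (lam A t) Θ = lam A (plug t Θ)
plug (app t u) Θ = app (plug t Θ) (plug u Θ)
plug hole      Θ = Θ

-- Typing.  The first argument is the type of the hole (nothing: no hole
-- allowed).

data _∋_∶_ : List Ty → ℕ → Ty → Set where
  here  : ∀ {Γ A} → (A ∷ Γ) ∋ zero ∶ A
  there : ∀ {Γ A B i} → Γ ∋ i ∶ A → (B ∷ Γ) ∋ suc i ∶ A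

data _∣_⊢_∶_ (H : Maybe Ty) : List Ty → Tm → Ty → Set where
  ⊢var  : ∀ {Γ i A} → Γ ∋ i ∶ A → H ∣ Γ ⊢ var i ∶ A
  ⊢lam  : ∀ {Γ t A B} → H ∣ (A ∷ Γ) ⊢ t ∶ B → H ∣ Γ ⊢ lam A t ∶ (A ⊸ B)
  ⊢app  : ∀ {Γ t u A B} → H ∣ Γ ⊢ t ∶ (A ⊸ B) → H ∣ Γ ⊢ u ∶ A → H ∣ Γ ⊢ app t u ∶ B
  ⊢hole : ∀ {Γ A} → H ≡ just A → H ∣ Γ ⊢ hole ∶ A

shift : ℕ → Tm → Tm
shift c (var j) with compare j c
... | less _ _    = var j
... | equal _     = var (suc j)
... | greater _ _ = var (suc j)
shift c (lam A t) = lam A (shift (suc c) t)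
shift c (app t u) = app (shift c t) (shift c u)
shift c hole      = hole

substAt : ℕ → Tm → Tm → Tm
substAt k u (var j) with compare j k
... | less _ _          = var j
... | equal _           = u
... | greater _ j'      = var (k + j')
substAt k u (lam A t) = lam A (substAt (suc k) (shift 0 u) t)
substAt k u (app t v) = app (substAt k u t) (substAt k u v)
substAt k u hole      = hole

data _⊢_≈_∶_ (Γ : List Ty) : Tm → Tm → Ty → Set where
  ≈refl  : ∀ {t A} → nothing ∣ Γ ⊢ t ∶ A → Γ ⊢ t ≈ t ∶ A
  ≈sym   : ∀ {t u A} → Γ ⊢ t ≈ u ∶ A → Γ ⊢ u ≈ t ∶ A
  ≈trans : ∀ {t u v A} → Γ ⊢ t ≈ u ∶ A → Γ ⊢ u ≈ v ∶ A → Γ ⊢ t ≈ v ∶ A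
  ≈lam   : ∀ {t t' A B} → (A ∷ Γ) ⊢ t ≈ t' ∶ B → Γ ⊢ lam A t ≈ lam A t' ∶ (A ⊸ B)
  ≈app   : ∀ {t t' u u' A B} → Γ ⊢ t ≈ t' ∶ (A ⊸ B) → Γ ⊢ u ≈ u' ∶ A →
           Γ ⊢ app t u ≈ app t' u' ∶ B
  ≈β     : ∀ {t u A B} → nothing ∣ (A ∷ Γ) ⊢ t ∶ B → nothing ∣ Γ ⊢ u ∶ A →
           Γ ⊢ app (lam A t) u ≈ substAt 0 u t ∶ B
  ≈η     : ∀ {t A B} → nothing ∣ Γ ⊢ t ∶ (A ⊸ B) →
           Γ ⊢ t ≈ lam A (app (shift 0 t) (var 0)) ∶ (A ⊸ B)

ClosedNet : Ty → Tm → Set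
ClosedNet A Θ = (nothing ∣ [] ⊢ Θ ∶ A) × Linear Θ

OneHoleContext : Ty → Ty → Tm → Set
OneHoleContext H B C = (just H ∣ [] ⊢ C ∶ B) × Linear C × holes C ≡ 1

Nat : Ty
Nat = p ⊸ (p ⊸ p) ⊸ (p ⊸ p) ⊸ p

-- λx.λf.λg. g (f x)
zero̲ : Tm
zero̲ = lam p (lam (p ⊸ p) (lam (p ⊸ p) (app (var 0) (app (var 1) (var 2)))))

-- λx.λf.λg. f (g x)
one̲ : Tm
one̲ = lam p (lam (p ⊸ p) (lam (p ⊸ p) (app (var 1) (app (var 0) (var 2)))))

-- A closed net of order < 4 has conclusion (p ⊸^k₁) ⊸ ⋯ ⊸ (p ⊸^kₙ) ⊸ p, so its βη-long normal
-- form is λx₁⋯xₙ. T where T is a first-order tree over the variables xᵢ, each used exactly once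
-- by linearity.  Such a tree is determined by its preorder word, a permutation of x₁⋯xₙ, so two
-- different nets yield permutations in which some pair u, v occurs in opposite orders.  After
-- instantiating p by Nat, the separating context feeds to each xᵢ a term which, evaluated on a
-- numeral-like argument, performs "f" if i = u, "g" if i = v and nothing otherwise, and then the
-- work of its arguments in order.  The plugged nets therefore compute g ∘ f and f ∘ g, that is
-- 0 and 1.  These computations are carried out in the set-theoretic model with p interpreted by
-- words over Bool: βη-conversion is sound for it (via a logical relation), and a normal closed
-- term of type Nat is read back from its value on the two letters.

module Submission where

open import Defs
open import Data.Nat using (ℕ; zero; suc; _+_; _*_; _⊔_; _<_; _≤_; _≟_; _<?_; z≤n; s≤s; compare; less; equal; greater)
open import Data.Nat.Properties
open import Data.Nat.Tactic.RingSolver using (solve-∀)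
open import Data.Nat.Induction using (<-wellFounded)
open import Induction.WellFounded using (Acc; acc)
open import Data.List using (List; []; _∷_; _++_; length; map; reverse; _ʳ++_)
open import Data.List.Properties using (length-++; ∷-injective; length-map; ++-assoc; length-reverse; map-ʳ++)
open import Data.List.Relation.Unary.All using (All; []; _∷_)
open import Data.Maybe using (Maybe; just; nothing)
open import Data.Maybe.Properties using (just-injective)
open import Data.Bool using (Bool; true; false)
open import Data.Product using (Σ; _×_; _,_; proj₁; proj₂)
open import Data.Sum using (_⊎_; inj₁; inj₂)
open import Data.Empty using (⊥-elim)
open import Data.Unit using (⊤; tt)
open import Relation.Binary.PropositionalEquality
  using (_≡_; refl; sym; trans; cong; cong₂; subst; subst₂; ≢-sym; module ≡-Reasoning)
open import Relation.Nullary using (¬_; yes; no)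
open import Function using (id)

shift-var-view : ∀ c j → (j < c × shift c (var j) ≡ var j) ⊎ (c ≤ j × shift c (var j) ≡ var (suc j))
shift-var-view c j with compare j c
... | less .j m    = inj₁ (s≤s (m≤m+n j m) , refl)
... | equal .j     = inj₂ (≤-refl , refl)
... | greater .c m = inj₂ (≤-trans (m≤m+n c m) (n≤1+n _) , refl)

substAt-var-view : ∀ k u j → (j < k × substAt k u (var j) ≡ var j)
                           ⊎ (j ≡ k × substAt k u (var j) ≡ u)
                           ⊎ Σ ℕ (λ m → j ≡ suc (k + m) × substAt k u (var j) ≡ var (k + m))
substAt-var-view k u j with compare j k
... | less .j m    = inj₁ (s≤s (m≤m+n j m) , refl)
... | equal .j     = inj₂ (inj₁ (refl , refl))
... | greater .k m = inj₂ (inj₂ (m , refl , refl))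

occ-var-view : ∀ i j → (i ≡ j × occ i (var j) ≡ 1) ⊎ (¬ i ≡ j × occ i (var j) ≡ 0)
occ-var-view i j with compare i j
... | less .i m    = inj₂ (<⇒≢ (s≤s (m≤m+n i m)) , refl)
... | equal .i     = inj₁ (refl , refl)
... | greater .j m = inj₂ (>⇒≢ (s≤s (m≤m+n j m)) , refl)

occ-var-self : ∀ i → occ i (var i) ≡ 1
occ-var-self i with occ-var-view i i
... | inj₁ (_ , e)  = e
... | inj₂ (i≢i , _) = ⊥-elim (i≢i refl)

occ-var-other : ∀ i j → ¬ i ≡ j → occ i (var j) ≡ 0
occ-var-other i j i≢j with occ-var-view i j
... | inj₁ (i≡j , _) = ⊥-elim (i≢j i≡j)
... | inj₂ (_ , e)   = e

occ-var-suc : ∀ i j → occ (suc i) (var (suc j)) ≡ occ i (var j)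
occ-var-suc i j with occ-var-view i j
... | inj₁ (refl , e) rewrite e = occ-var-self (suc i)
... | inj₂ (i≢j , e)  rewrite e = occ-var-other (suc i) (suc j) (λ eq → i≢j (suc-injective eq))

occ-shift-below : ∀ c i t → i < c → occ i (shift c t) ≡ occ i t
occ-shift-below c i (var j) i<c with shift-var-view c j
... | inj₁ (_ , e)    rewrite e = refl
... | inj₂ (c≤j , e) rewrite e =
  trans (occ-var-other i (suc j) (<⇒≢ (≤-trans i<c (≤-trans c≤j (n≤1+n j)))))
        (sym (occ-var-other i j (<⇒≢ (≤-trans i<c c≤j))))
occ-shift-below c i (lam A t) i<c = occ-shift-below (suc c) (suc i) t (s≤s i<c)
occ-shift-below c i (app t u) i<c = cong₂ _+_ (occ-shift-below c i t i<c) (occ-shift-below c i u i<c)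
occ-shift-below c i hole      i<c = refl

occ-shift-at : ∀ c t → occ c (shift c t) ≡ 0
occ-shift-at c (var j) with shift-var-view c j
... | inj₁ (j<c , e) rewrite e = occ-var-other c j (>⇒≢ j<c)
... | inj₂ (c≤j , e) rewrite e = occ-var-other c (suc j) (<⇒≢ (s≤s c≤j))
occ-shift-at c (lam A t) = occ-shift-at (suc c) t
occ-shift-at c (app t u) = cong₂ _+_ (occ-shift-at c t) (occ-shift-at c u)
occ-shift-at c hole      = refl

occ-shift-above : ∀ c i t → c ≤ i → occ (suc i) (shift c t) ≡ occ i t
occ-shift-above c i (var j) c≤i with shift-var-view c j
... | inj₁ (j<c , e) rewrite e =
  trans (occ-var-other (suc i) j (>⇒≢ (≤-trans j<c (≤-trans c≤i (n≤1+n i)))))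
        (sym (occ-var-other i j (>⇒≢ (≤-trans j<c c≤i))))
... | inj₂ (_ , e) rewrite e = occ-var-suc i j
occ-shift-above c i (lam A t) c≤i = occ-shift-above (suc c) (suc i) t (s≤s c≤i)
occ-shift-above c i (app t u) c≤i = cong₂ _+_ (occ-shift-above c i t c≤i) (occ-shift-above c i u c≤i)
occ-shift-above c i hole      c≤i = refl

affine-+ : ∀ a b c d x → (a + c * x) + (b + d * x) ≡ (a + b) + (c + d) * x
affine-+ = solve-∀

occ-substAt-below : ∀ k u t i → i < k → occ i (substAt k u t) ≡ occ i t + occ k t * occ i u
occ-substAt-below k u (var j) i i<k with substAt-var-view k u j
... | inj₁ (j<k , e) rewrite e | occ-var-other k j (>⇒≢ j<k) = sym (+-identityʳ _)
... | inj₂ (inj₁ (refl , e)) rewrite e | occ-var-self j | occ-var-other i j (<⇒≢ i<k) =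
  sym (+-identityʳ _)
... | inj₂ (inj₂ (m , refl , e)) rewrite e
  | occ-var-other k (suc (k + m)) (<⇒≢ (s≤s (m≤m+n k m)))
  | occ-var-other i (k + m) (<⇒≢ (≤-trans i<k (m≤m+n k m)))
  | occ-var-other i (suc (k + m)) (<⇒≢ (≤-trans i<k (≤-trans (m≤m+n k m) (n≤1+n _)))) = refl
occ-substAt-below k u (lam A t) i i<k
  rewrite occ-substAt-below (suc k) (shift 0 u) t (suc i) (s≤s i<k) | occ-shift-above 0 i u z≤n = refl
occ-substAt-below k u (app t v) i i<k
  rewrite occ-substAt-below k u t i i<k | occ-substAt-below k u v i i<k =
  affine-+ (occ i t) (occ i v) (occ k t) (occ k v) (occ i u)
occ-substAt-below k u hole i i<k = refl

occ-substAt-above : ∀ k u t i → k ≤ i → occ i (substAt k u t) ≡ occ (suc i) t + occ k t * occ i u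
occ-substAt-above k u (var j) i k≤i with substAt-var-view k u j
... | inj₁ (j<k , e) rewrite e
  | occ-var-other k j (>⇒≢ j<k)
  | occ-var-other i j (>⇒≢ (≤-trans j<k k≤i))
  | occ-var-other (suc i) j (>⇒≢ (≤-trans j<k (≤-trans k≤i (n≤1+n i)))) = refl
... | inj₂ (inj₁ (refl , e)) rewrite e | occ-var-self j | occ-var-other (suc i) j (>⇒≢ (s≤s k≤i)) =
  sym (+-identityʳ _)
... | inj₂ (inj₂ (m , refl , e)) rewrite e
  | occ-var-other k (suc (k + m)) (<⇒≢ (s≤s (m≤m+n k m)))
  | occ-var-suc i (k + m) = sym (+-identityʳ _)
occ-substAt-above k u (lam A t) i k≤i
  rewrite occ-substAt-above (suc k) (shift 0 u) t (suc i) (s≤s k≤i) | occ-shift-above 0 i u z≤n = refl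
occ-substAt-above k u (app t v) i k≤i
  rewrite occ-substAt-above k u t i k≤i | occ-substAt-above k u v i k≤i =
  affine-+ (occ (suc i) t) (occ (suc i) v) (occ k t) (occ k v) (occ i u)
occ-substAt-above k u hole i k≤i = refl

Linear-shift : ∀ c t → Linear t → Linear (shift c t)
Linear-shift c (var j) L with shift-var-view c j
... | inj₁ (_ , e) rewrite e = L
... | inj₂ (_ , e) rewrite e = L
Linear-shift c (lam A t) (o , L) = trans (occ-shift-below (suc c) 0 t (s≤s z≤n)) o , Linear-shift (suc c) t L
Linear-shift c (app t u) (L₁ , L₂) = Linear-shift c t L₁ , Linear-shift c u L₂
Linear-shift c hole      L = L

Linear-substAt : ∀ k u t → Linear t → Linear u → Linear (substAt k u t)
Linear-substAt k u (var j) L Lu with substAt-var-view k u j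
... | inj₁ (_ , e)              rewrite e = L
... | inj₂ (inj₁ (_ , e))       rewrite e = Lu
... | inj₂ (inj₂ (_ , _ , e))   rewrite e = L
Linear-substAt k u (lam A t) (o , L) Lu = occ-body , Linear-substAt (suc k) (shift 0 u) t L (Linear-shift 0 u Lu)
  where
  open ≡-Reasoning
  occ-body : occ 0 (substAt (suc k) (shift 0 u) t) ≡ 1
  occ-body = begin
    occ 0 (substAt (suc k) (shift 0 u) t)               ≡⟨ occ-substAt-below (suc k) (shift 0 u) t 0 (s≤s z≤n) ⟩
    occ 0 t + occ (suc k) t * occ 0 (shift 0 u)         ≡⟨ cong₂ (λ a b → a + occ (suc k) t * b) o (occ-shift-at 0 u) ⟩
    1 + occ (suc k) t * 0                               ≡⟨ cong suc (*-zeroʳ (occ (suc k) t)) ⟩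
    1                                                   ∎
Linear-substAt k u (app t v) (L₁ , L₂) Lu = Linear-substAt k u t L₁ Lu , Linear-substAt k u v L₂ Lu
Linear-substAt k u hole      L Lu = L

size : Tm → ℕ
size (var _)   = 1
size (lam _ t) = suc (size t)
size (app t u) = suc (size t + size u)
size hole      = 1

size-shift : ∀ c t → size (shift c t) ≡ size t
size-shift c (var j) with shift-var-view c j
... | inj₁ (_ , e) rewrite e = refl
... | inj₂ (_ , e) rewrite e = refl
size-shift c (lam A t) = cong suc (size-shift (suc c) t)
size-shift c (app t u) = cong₂ (λ a b → suc (a + b)) (size-shift c t) (size-shift c u)
size-shift c hole      = refl

-- Stated with occ k t added on the left so that no subtraction is needed.
size-substAt : ∀ k u t → size (substAt k u t) + occ k t ≡ size t + occ k t * size u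
size-substAt k u (var j) with substAt-var-view k u j
... | inj₁ (j<k , e) rewrite e | occ-var-other k j (>⇒≢ j<k) = refl
... | inj₂ (inj₁ (refl , e)) rewrite e | occ-var-self j = trans (+-comm (size u) 1) (cong suc (sym (+-identityʳ _)))
... | inj₂ (inj₂ (m , refl , e)) rewrite e | occ-var-other k (suc (k + m)) (<⇒≢ (s≤s (m≤m+n k m))) = refl
size-substAt k u (lam A t) rewrite sym (size-shift 0 u) = cong suc (size-substAt (suc k) (shift 0 u) t)
size-substAt k u (app t v) = begin
  suc (size (substAt k u t) + size (substAt k u v)) + (occ k t + occ k v)
    ≡⟨ regroup (size (substAt k u t)) (size (substAt k u v)) (occ k t) (occ k v) ⟩
  suc ((size (substAt k u t) + occ k t) + (size (substAt k u v) + occ k v))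
    ≡⟨ cong₂ (λ a b → suc (a + b)) (size-substAt k u t) (size-substAt k u v) ⟩
  suc ((size t + occ k t * size u) + (size v + occ k v * size u))
    ≡⟨ cong suc (affine-+ (size t) (size v) (occ k t) (occ k v) (size u)) ⟩
  suc (size t + size v) + (occ k t + occ k v) * size u
    ∎
  where
  open ≡-Reasoning
  regroup : ∀ a b c d → suc (a + b) + (c + d) ≡ suc ((a + c) + (b + d))
  regroup = solve-∀
size-substAt k u hole = refl

size-β : ∀ b u → occ 0 b ≡ 1 → suc (size (substAt 0 u b)) ≡ size b + size u
size-β b u o = begin
  suc (size (substAt 0 u b))      ≡⟨ +-comm 1 _ ⟩
  size (substAt 0 u b) + 1        ≡⟨ cong (size (substAt 0 u b) +_) (sym o) ⟩
  size (substAt 0 u b) + occ 0 b  ≡⟨ size-substAt 0 u b ⟩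
  size b + occ 0 b * size u       ≡⟨ cong (λ x → size b + x * size u) o ⟩
  size b + (size u + 0)           ≡⟨ cong (size b +_) (+-identityʳ _) ⟩
  size b + size u                 ∎
  where open ≡-Reasoning

∋-prefix : ∀ (Γ₁ : List Ty) {Y Z : List Ty} {j B} → j < length Γ₁ → (Γ₁ ++ Y) ∋ j ∶ B → (Γ₁ ++ Z) ∋ j ∶ B
∋-prefix (_ ∷ Γ₁) j<     here      = here
∋-prefix (_ ∷ Γ₁) (s≤s j<) (there l) = there (∋-prefix Γ₁ j< l)

∋-at-split : ∀ (Γ₁ : List Ty) {A Γ₂ B} → (Γ₁ ++ A ∷ Γ₂) ∋ length Γ₁ ∶ B → B ≡ A
∋-at-split []       here      = refl
∋-at-split (_ ∷ Γ₁) (there l) = ∋-at-split Γ₁ l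

∋-drop : ∀ (Γ₁ : List Ty) {A Γ₂ B} m → (Γ₁ ++ A ∷ Γ₂) ∋ suc (length Γ₁ + m) ∶ B →
         (Γ₁ ++ Γ₂) ∋ length Γ₁ + m ∶ B
∋-drop []       m (there l) = l
∋-drop (_ ∷ Γ₁) m (there l) = there (∋-drop Γ₁ m l)

∋-insert : ∀ (Γ₁ : List Ty) {A Γ₂ B j} → length Γ₁ ≤ j → (Γ₁ ++ Γ₂) ∋ j ∶ B →
           (Γ₁ ++ A ∷ Γ₂) ∋ suc j ∶ B
∋-insert []       _        l         = there l
∋-insert (_ ∷ Γ₁) (s≤s ≤j) (there l) = there (∋-insert Γ₁ ≤j l)

weaken : ∀ {H} (Γ₁ : List Ty) {Γ₂ t A} B → H ∣ (Γ₁ ++ Γ₂) ⊢ t ∶ A →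
         H ∣ (Γ₁ ++ B ∷ Γ₂) ⊢ shift (length Γ₁) t ∶ A
weaken Γ₁ B (⊢var {i = j} l) with shift-var-view (length Γ₁) j
... | inj₁ (j< , e) rewrite e = ⊢var (∋-prefix Γ₁ j< l)
... | inj₂ (≤j , e) rewrite e = ⊢var (∋-insert Γ₁ ≤j l)
weaken Γ₁ B (⊢lam {A = A} D) = ⊢lam (weaken (A ∷ Γ₁) B D)
weaken Γ₁ B (⊢app D E)       = ⊢app (weaken Γ₁ B D) (weaken Γ₁ B E)
weaken Γ₁ B (⊢hole e)        = ⊢hole e

weaken₀ : ∀ {H Γ t A} B → H ∣ Γ ⊢ t ∶ A → H ∣ (B ∷ Γ) ⊢ shift 0 t ∶ A
weaken₀ = weaken []

substAt-typed : ∀ (Γ₁ : List Ty) {Γ₂ t A B u} →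
                nothing ∣ (Γ₁ ++ A ∷ Γ₂) ⊢ t ∶ B → nothing ∣ (Γ₁ ++ Γ₂) ⊢ u ∶ A →
                nothing ∣ (Γ₁ ++ Γ₂) ⊢ substAt (length Γ₁) u t ∶ B
substAt-typed Γ₁ {u = u} (⊢var {i = j} l) U with substAt-var-view (length Γ₁) u j
... | inj₁ (j< , e)              rewrite e = ⊢var (∋-prefix Γ₁ j< l)
... | inj₂ (inj₁ (refl , e))     rewrite e | ∋-at-split Γ₁ l = U
... | inj₂ (inj₂ (m , refl , e)) rewrite e = ⊢var (∋-drop Γ₁ m l)
substAt-typed Γ₁ (⊢lam {A = A} D) U = ⊢lam (substAt-typed (A ∷ Γ₁) D (weaken₀ A U))
substAt-typed Γ₁ (⊢app D E)       U = ⊢app (substAt-typed Γ₁ D U) (substAt-typed Γ₁ E U)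

substAt₀-typed : ∀ {Γ t A B u} → nothing ∣ (A ∷ Γ) ⊢ t ∶ B → nothing ∣ Γ ⊢ u ∶ A →
                 nothing ∣ Γ ⊢ substAt 0 u t ∶ B
substAt₀-typed = substAt-typed []

∋-type-unique : ∀ {Γ i A B} → Γ ∋ i ∶ A → Γ ∋ i ∶ B → A ≡ B
∋-type-unique here      here       = refl
∋-type-unique (there l) (there l') = ∋-type-unique l l'

∋-irrelevant : ∀ {Γ i A} (l l' : Γ ∋ i ∶ A) → l ≡ l'
∋-irrelevant here      here       = refl
∋-irrelevant (there l) (there l') = cong there (∋-irrelevant l l')

⊢-type-unique : ∀ {Γ t A B} → nothing ∣ Γ ⊢ t ∶ A → nothing ∣ Γ ⊢ t ∶ B → A ≡ B
⊢-type-unique (⊢var l)   (⊢var l')    = ∋-type-unique l l'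
⊢-type-unique (⊢lam D)   (⊢lam D')    = cong (_ ⊸_) (⊢-type-unique D D')
⊢-type-unique (⊢app D E) (⊢app D' E') with ⊢-type-unique D D'
... | refl = refl

⊢-irrelevant : ∀ {Γ t A} (D D' : nothing ∣ Γ ⊢ t ∶ A) → D ≡ D'
⊢-irrelevant (⊢var l)   (⊢var l')    = cong ⊢var (∋-irrelevant l l')
⊢-irrelevant (⊢lam D)   (⊢lam D')    = cong ⊢lam (⊢-irrelevant D D')
⊢-irrelevant (⊢app D E) (⊢app D' E') with ⊢-type-unique E E'
... | refl = cong₂ ⊢app (⊢-irrelevant D D') (⊢-irrelevant E E')

≈-typed : ∀ {Γ t t' A} → Γ ⊢ t ≈ t' ∶ A → (nothing ∣ Γ ⊢ t ∶ A) × (nothing ∣ Γ ⊢ t' ∶ A)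
≈-typed (≈refl D)    = D , D
≈-typed (≈sym e)     = proj₂ (≈-typed e) , proj₁ (≈-typed e)
≈-typed (≈trans e e') = proj₁ (≈-typed e) , proj₂ (≈-typed e')
≈-typed (≈lam e)     = ⊢lam (proj₁ (≈-typed e)) , ⊢lam (proj₂ (≈-typed e))
≈-typed (≈app e e')  = ⊢app (proj₁ (≈-typed e)) (proj₁ (≈-typed e')) , ⊢app (proj₂ (≈-typed e)) (proj₂ (≈-typed e'))
≈-typed (≈β D U)     = ⊢app (⊢lam D) U , substAt₀-typed D U
≈-typed (≈η {A = A} D) = D , ⊢lam (⊢app (weaken₀ A D) (⊢var here))

mutual
  data Ne : Tm → Set where
    nvar : ∀ {i} → Ne (var i)
    napp : ∀ {t u} → Ne t → Nf u → Ne (app t u)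

  data Nf : Tm → Set where
    nlam : ∀ {A t} → Nf t → Nf (lam A t)
    nne  : ∀ {t} → Ne t → Nf t

record NormalForm (Γ : List Ty) (t : Tm) (A : Ty) : Set where
  constructor normalForm
  field
    nf        : Tm
    ≈nf       : Γ ⊢ t ≈ nf ∶ A
    nf-normal : Nf nf
    nf-typed  : nothing ∣ Γ ⊢ nf ∶ A
    nf-linear : Linear nf
    nf-occ    : ∀ i → occ i nf ≡ occ i t
    nf-size   : size nf ≤ size t

-- Linearity makes β-reduction shrink the term, which is the termination measure.
size-contractum< : ∀ {t u u'} b → occ 0 b ≡ 1 → size b < size t → size u' ≤ size u →
                   size (substAt 0 u' b) < size (app t u)
size-contractum< {t = t} {u} {u'} b ob st su = begin-strict
  size (substAt 0 u' b)          <⟨ n<1+n _ ⟩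
  suc (size (substAt 0 u' b))    ≡⟨ size-β b u' ob ⟩
  size b + size u'               ≤⟨ +-mono-≤ (n≤1+n (size b)) su ⟩
  suc (size b) + size u          ≤⟨ +-monoˡ-≤ (size u) st ⟩
  size t + size u                <⟨ n<1+n _ ⟩
  size (app t u)                 ∎
  where open ≤-Reasoning

normalise-app : ∀ {Γ A B t u} →
  (∀ {C} s → size s < size (app t u) → nothing ∣ Γ ⊢ s ∶ C → Linear s → NormalForm Γ s C) →
  NormalForm Γ t (A ⊸ B) → NormalForm Γ u A → NormalForm Γ (app t u) B
normalise-app _ (normalForm t' t≈ (nne ne) Dt Lt ot st) (normalForm u' u≈ nu Du Lu ou su) =
  normalForm (app t' u') (≈app t≈ u≈) (nne (napp ne nu)) (⊢app Dt Du) (Lt , Lu)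
             (λ i → cong₂ _+_ (ot i) (ou i)) (s≤s (+-mono-≤ st su))
normalise-app {t = t} {u} rec (normalForm (lam A b) t≈ (nlam _) (⊢lam Db) (ob , Lb) ot st)
                              (normalForm u' u≈ _ Du Lu ou su)
  with rec (substAt 0 u' b) (size-contractum< b ob st su) (substAt₀-typed Db Du) (Linear-substAt 0 u' b Lb Lu)
... | normalForm r r≈ nr Dr Lr or sr =
  normalForm r (≈trans (≈app t≈ u≈) (≈trans (≈β Db Du) r≈)) nr Dr Lr occ-r
             (≤-trans sr (<⇒≤ (size-contractum< b ob st su)))
  where
  open ≡-Reasoning
  occ-r : ∀ i → occ i r ≡ occ i t + occ i u
  occ-r i = begin
    occ i r                              ≡⟨ or i ⟩
    occ i (substAt 0 u' b)               ≡⟨ occ-substAt-above 0 u' b i z≤n ⟩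
    occ (suc i) b + occ 0 b * occ i u'   ≡⟨ cong (λ x → occ (suc i) b + x * occ i u') ob ⟩
    occ (suc i) b + (occ i u' + 0)       ≡⟨ cong (occ (suc i) b +_) (+-identityʳ _) ⟩
    occ (suc i) b + occ i u'             ≡⟨ cong₂ _+_ (ot i) (ou i) ⟩
    occ i t + occ i u                    ∎

normalise-acc : ∀ {Γ A} t → Acc _<_ (size t) → nothing ∣ Γ ⊢ t ∶ A → Linear t → NormalForm Γ t A
normalise-acc (var i) _ D L = normalForm (var i) (≈refl D) (nne nvar) D L (λ _ → refl) ≤-refl
normalise-acc (lam A t) (acc rs) (⊢lam D) (o , L) with normalise-acc t (rs ≤-refl) D L
... | normalForm t' t≈ nt Dt Lt ot st =
  normalForm (lam A t') (≈lam t≈) (nlam nt) (⊢lam Dt) (trans (ot 0) o , Lt) (λ i → ot (suc i)) (s≤s st)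
normalise-acc (app t u) (acc rs) (⊢app D E) (Lt , Lu) =
  normalise-app (λ s s< → normalise-acc s (rs s<))
                (normalise-acc t (rs (s≤s (m≤m+n _ _))) D Lt)
                (normalise-acc u (rs (s≤s (m≤n+m _ _))) E Lu)
normalise-acc hole _ (⊢hole ()) _

normalise : ∀ {Γ A} t → nothing ∣ Γ ⊢ t ∶ A → Linear t → NormalForm Γ t A
normalise t = normalise-acc t (<-wellFounded (size t))

module SetModel (X : Set) where

  ⟦_⟧ : Ty → Set
  ⟦ p ⟧     = X
  ⟦ A ⊸ B ⟧ = ⟦ A ⟧ → ⟦ B ⟧

  infixr 5 _∷E_
  data Env : List Ty → Set where
    []E  : Env []
    _∷E_ : ∀ {A Γ} → ⟦ A ⟧ → Env Γ → Env (A ∷ Γ)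

  _++E_ : ∀ {Γ₁ Γ₂} → Env Γ₁ → Env Γ₂ → Env (Γ₁ ++ Γ₂)
  []E      ++E σ = σ
  (x ∷E ρ) ++E σ = x ∷E (ρ ++E σ)

  lookupE : ∀ {Γ i A} → Γ ∋ i ∶ A → Env Γ → ⟦ A ⟧
  lookupE here      (x ∷E _) = x
  lookupE (there l) (_ ∷E ρ) = lookupE l ρ

  eval : ∀ {Γ t A} → nothing ∣ Γ ⊢ t ∶ A → Env Γ → ⟦ A ⟧
  eval (⊢var l)   ρ = lookupE l ρ
  eval (⊢lam D)   ρ = λ x → eval D (x ∷E ρ)
  eval (⊢app D E) ρ = eval D ρ (eval E ρ)

  -- Set-theoretic functions are not extensional in Agda, so equality of denotations is
  -- replaced by this logical relation; it is a partial equivalence, not reflexive.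
  Related : (A : Ty) → ⟦ A ⟧ → ⟦ A ⟧ → Set
  Related p       x y = x ≡ y
  Related (A ⊸ B) f g = ∀ x y → Related A x y → Related B (f x) (g y)

  Related-sym : ∀ A {x y} → Related A x y → Related A y x
  Related-sym p       x≡y         = sym x≡y
  Related-sym (A ⊸ B) f~g x y x~y = Related-sym B (f~g y x (Related-sym A x~y))

  Related-trans : ∀ A {x y z} → Related A x y → Related A y z → Related A x z
  Related-trans p       x≡y y≡z = trans x≡y y≡z
  Related-trans (A ⊸ B) f~g g~h x y x~y =
    Related-trans B (f~g x x (Related-trans A x~y (Related-sym A x~y))) (g~h x y x~y)

  RelatedEnv : ∀ {Γ} → Env Γ → Env Γ → Set
  RelatedEnv []E      []E      = ⊤
  RelatedEnv (x ∷E ρ) (y ∷E σ) = Related _ x y × RelatedEnv ρ σ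

  RelatedEnv-sym : ∀ {Γ} {ρ σ : Env Γ} → RelatedEnv ρ σ → RelatedEnv σ ρ
  RelatedEnv-sym {ρ = []E}     {[]E}     _        = tt
  RelatedEnv-sym {ρ = x ∷E ρ} {y ∷E σ} (r , rs) = Related-sym _ r , RelatedEnv-sym rs

  RelatedEnv-trans : ∀ {Γ} {ρ σ τ : Env Γ} → RelatedEnv ρ σ → RelatedEnv σ τ → RelatedEnv ρ τ
  RelatedEnv-trans {ρ = []E}     {[]E}     {[]E}     _        _          = tt
  RelatedEnv-trans {ρ = x ∷E ρ} {y ∷E σ} {z ∷E τ} (r , rs) (r' , rs') = Related-trans _ r r' , RelatedEnv-trans rs rs'

  RelatedEnv-reflˡ : ∀ {Γ} {ρ σ : Env Γ} → RelatedEnv ρ σ → RelatedEnv ρ ρ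
  RelatedEnv-reflˡ r = RelatedEnv-trans r (RelatedEnv-sym r)

  RelatedEnv-++ : ∀ {Γ₁ Γ₂} {ρ₁ σ₁ : Env Γ₁} {ρ₂ σ₂ : Env Γ₂} →
                  RelatedEnv ρ₁ σ₁ → RelatedEnv ρ₂ σ₂ → RelatedEnv (ρ₁ ++E ρ₂) (σ₁ ++E σ₂)
  RelatedEnv-++ {ρ₁ = []E}     {[]E}     _        r₂ = r₂
  RelatedEnv-++ {ρ₁ = x ∷E ρ₁} {y ∷E σ₁} (r , r₁) r₂ = r , RelatedEnv-++ r₁ r₂

  lookupE-related : ∀ {Γ i A} (l l' : Γ ∋ i ∶ A) {ρ σ : Env Γ} → RelatedEnv ρ σ → Related A (lookupE l ρ) (lookupE l' σ)
  lookupE-related here      here       {_ ∷E _} {_ ∷E _} (r , _)  = r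
  lookupE-related (there l) (there l') {_ ∷E _} {_ ∷E _} (_ , rs) = lookupE-related l l' rs

  eval-related : ∀ {Γ t A} (D D' : nothing ∣ Γ ⊢ t ∶ A) {ρ σ} → RelatedEnv ρ σ → Related A (eval D ρ) (eval D' σ)
  eval-related D D' r rewrite ⊢-irrelevant D D' = go D' r
    where
    go : ∀ {Γ t A} (D : nothing ∣ Γ ⊢ t ∶ A) {ρ σ} → RelatedEnv ρ σ → Related A (eval D ρ) (eval D σ)
    go (⊢var l)   r         = lookupE-related l l r
    go (⊢lam D)   r x y x~y = go D (x~y , r)
    go (⊢app D E) r         = go D r _ _ (go E r)

  lookupE-prefix : ∀ (Γ₁ : List Ty) {Y Z j A} (l : (Γ₁ ++ Y) ∋ j ∶ A) (l' : (Γ₁ ++ Z) ∋ j ∶ A) → j < length Γ₁ →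
                   ∀ (ρ₁ σ₁ : Env Γ₁) (α : Env Y) (β : Env Z) → RelatedEnv ρ₁ σ₁ →
                   Related A (lookupE l (ρ₁ ++E α)) (lookupE l' (σ₁ ++E β))
  lookupE-prefix (_ ∷ Γ₁) here      here       _        (_ ∷E _)  (_ ∷E _)  α β (r , _) = r
  lookupE-prefix (_ ∷ Γ₁) (there l) (there l') (s≤s j<) (_ ∷E ρ₁) (_ ∷E σ₁) α β (_ , r) =
    lookupE-prefix Γ₁ l l' j< ρ₁ σ₁ α β r

  lookupE-insert : ∀ (Γ₁ : List Ty) {Γ₂ B j A} (l : (Γ₁ ++ Γ₂) ∋ j ∶ A) (l' : (Γ₁ ++ B ∷ Γ₂) ∋ suc j ∶ A) →
                   length Γ₁ ≤ j → ∀ (ρ₁ σ₁ : Env Γ₁) x (ρ₂ σ₂ : Env Γ₂) →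
                   RelatedEnv ρ₁ σ₁ → RelatedEnv ρ₂ σ₂ →
                   Related A (lookupE l' (ρ₁ ++E (x ∷E ρ₂))) (lookupE l (σ₁ ++E σ₂))
  lookupE-insert []       l         (there l') _        []E       []E       x ρ₂ σ₂ _        r₂ = lookupE-related l' l r₂
  lookupE-insert (_ ∷ Γ₁) (there l) (there l') (s≤s ≤j) (_ ∷E ρ₁) (_ ∷E σ₁) x ρ₂ σ₂ (_ , r₁) r₂ =
    lookupE-insert Γ₁ l l' ≤j ρ₁ σ₁ x ρ₂ σ₂ r₁ r₂

  lookupE-at-split : ∀ (Γ₁ : List Ty) {A Γ₂} (l : (Γ₁ ++ A ∷ Γ₂) ∋ length Γ₁ ∶ A)
                     (σ₁ : Env Γ₁) y (σ₂ : Env Γ₂) →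
                     lookupE l (σ₁ ++E (y ∷E σ₂)) ≡ y
  lookupE-at-split []       here      []E       y σ₂ = refl
  lookupE-at-split (_ ∷ Γ₁) (there l) (_ ∷E σ₁) y σ₂ = lookupE-at-split Γ₁ l σ₁ y σ₂

  lookupE-drop : ∀ (Γ₁ : List Ty) {A Γ₂ B} m (l : (Γ₁ ++ A ∷ Γ₂) ∋ suc (length Γ₁ + m) ∶ B)
                 (l' : (Γ₁ ++ Γ₂) ∋ length Γ₁ + m ∶ B) →
                 ∀ (ρ₁ σ₁ : Env Γ₁) (ρ₂ σ₂ : Env Γ₂) y → RelatedEnv ρ₁ σ₁ → RelatedEnv ρ₂ σ₂ →
                 Related B (lookupE l' (ρ₁ ++E ρ₂)) (lookupE l (σ₁ ++E (y ∷E σ₂)))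
  lookupE-drop []       m (there l) l'         []E       []E       ρ₂ σ₂ y _        r₂ = lookupE-related l' l r₂
  lookupE-drop (_ ∷ Γ₁) m (there l) (there l') (_ ∷E ρ₁) (_ ∷E σ₁) ρ₂ σ₂ y (_ , r₁) r₂ =
    lookupE-drop Γ₁ m l l' ρ₁ σ₁ ρ₂ σ₂ y r₁ r₂

  eval-shift : ∀ (Γ₁ : List Ty) {Γ₂ B t t' A} → shift (length Γ₁) t ≡ t' →
               (D : nothing ∣ (Γ₁ ++ Γ₂) ⊢ t ∶ A) (D' : nothing ∣ (Γ₁ ++ B ∷ Γ₂) ⊢ t' ∶ A) →
               ∀ (ρ₁ σ₁ : Env Γ₁) x (ρ₂ σ₂ : Env Γ₂) → RelatedEnv ρ₁ σ₁ → RelatedEnv ρ₂ σ₂ →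
               Related A (eval D' (ρ₁ ++E (x ∷E ρ₂))) (eval D (σ₁ ++E σ₂))
  eval-shift Γ₁ {t = var j} e (⊢var l) D' ρ₁ σ₁ x ρ₂ σ₂ r₁ r₂ with shift-var-view (length Γ₁) j
  ... | inj₁ (j< , e₂) with trans (sym e₂) e
  ...   | refl with D'
  ...     | ⊢var l' = Related-sym _ (lookupE-prefix Γ₁ l l' j< σ₁ ρ₁ σ₂ (x ∷E ρ₂) (RelatedEnv-sym r₁))
  eval-shift Γ₁ {t = var j} e (⊢var l) D' ρ₁ σ₁ x ρ₂ σ₂ r₁ r₂ | inj₂ (≤j , e₂) with trans (sym e₂) e
  ...   | refl with D'
  ...     | ⊢var l' = lookupE-insert Γ₁ l l' ≤j ρ₁ σ₁ x ρ₂ σ₂ r₁ r₂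
  eval-shift Γ₁ refl (⊢lam {A = A} D) (⊢lam D') ρ₁ σ₁ x ρ₂ σ₂ r₁ r₂ a b a~b =
    eval-shift (A ∷ Γ₁) refl D D' (a ∷E ρ₁) (b ∷E σ₁) x ρ₂ σ₂ (a~b , r₁) r₂
  eval-shift Γ₁ {B = B} refl (⊢app D E) (⊢app D' E') ρ₁ σ₁ x ρ₂ σ₂ r₁ r₂ with ⊢-type-unique (weaken Γ₁ B E) E'
  ... | refl = eval-shift Γ₁ refl D D' ρ₁ σ₁ x ρ₂ σ₂ r₁ r₂ _ _
                          (eval-shift Γ₁ refl E E' ρ₁ σ₁ x ρ₂ σ₂ r₁ r₂)

  eval-substAt : ∀ (Γ₁ : List Ty) {Γ₂ A B t u t'} → substAt (length Γ₁) u t ≡ t' →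
                 (D : nothing ∣ (Γ₁ ++ A ∷ Γ₂) ⊢ t ∶ B) (U : nothing ∣ (Γ₁ ++ Γ₂) ⊢ u ∶ A)
                 (D' : nothing ∣ (Γ₁ ++ Γ₂) ⊢ t' ∶ B) →
                 ∀ (ρ₁ σ₁ : Env Γ₁) (ρ₂ σ₂ : Env Γ₂) y → RelatedEnv ρ₁ σ₁ → RelatedEnv ρ₂ σ₂ →
                 Related A (eval U (ρ₁ ++E ρ₂)) y →
                 Related B (eval D' (ρ₁ ++E ρ₂)) (eval D (σ₁ ++E (y ∷E σ₂)))
  eval-substAt Γ₁ {t = var j} {u = u} e (⊢var l) U D' ρ₁ σ₁ ρ₂ σ₂ y r₁ r₂ ry with substAt-var-view (length Γ₁) u j
  ... | inj₁ (j< , e₂) with trans (sym e₂) e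
  ...   | refl with D'
  ...     | ⊢var l' = lookupE-prefix Γ₁ l' l j< ρ₁ σ₁ ρ₂ (y ∷E σ₂) r₁
  eval-substAt Γ₁ {t = var j} {u = u} e (⊢var l) U D' ρ₁ σ₁ ρ₂ σ₂ y r₁ r₂ ry | inj₂ (inj₁ (refl , e₂))
    with trans (sym e₂) e
  ...   | refl with ∋-at-split Γ₁ l
  ...     | refl rewrite ⊢-irrelevant D' U | lookupE-at-split Γ₁ l σ₁ y σ₂ = ry
  eval-substAt Γ₁ {t = var j} {u = u} e (⊢var l) U D' ρ₁ σ₁ ρ₂ σ₂ y r₁ r₂ ry | inj₂ (inj₂ (m , refl , e₂))
    with trans (sym e₂) e
  ...   | refl with D'
  ...     | ⊢var l' = lookupE-drop Γ₁ m l l' ρ₁ σ₁ ρ₂ σ₂ y r₁ r₂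
  eval-substAt Γ₁ refl (⊢lam {A = A} D) U (⊢lam D') ρ₁ σ₁ ρ₂ σ₂ y r₁ r₂ ry a b a~b =
    eval-substAt (A ∷ Γ₁) refl D (weaken₀ A U) D' (a ∷E ρ₁) (b ∷E σ₁) ρ₂ σ₂ y (a~b , r₁) r₂
      (Related-trans _ (eval-shift [] refl U (weaken₀ A U) []E []E a (ρ₁ ++E ρ₂) (ρ₁ ++E ρ₂) tt
                                   (RelatedEnv-reflˡ (RelatedEnv-++ r₁ r₂))) ry)
  eval-substAt Γ₁ refl (⊢app D E) U (⊢app D' E') ρ₁ σ₁ ρ₂ σ₂ y r₁ r₂ ry
    with ⊢-type-unique (substAt-typed Γ₁ E U) E'
  ... | refl = eval-substAt Γ₁ refl D U D' ρ₁ σ₁ ρ₂ σ₂ y r₁ r₂ ry _ _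
                            (eval-substAt Γ₁ refl E U E' ρ₁ σ₁ ρ₂ σ₂ y r₁ r₂ ry)

  ≈-sound : ∀ {Γ t t' A} → Γ ⊢ t ≈ t' ∶ A → (D : nothing ∣ Γ ⊢ t ∶ A) (D' : nothing ∣ Γ ⊢ t' ∶ A) →
            ∀ {ρ σ} → RelatedEnv ρ σ → Related A (eval D ρ) (eval D' σ)
  ≈-sound (≈refl _) D D' r = eval-related D D' r
  ≈-sound (≈sym e)  D D' r = Related-sym _ (≈-sound e D' D (RelatedEnv-sym r))
  ≈-sound (≈trans e e') D D' r =
    Related-trans _ (≈-sound e D (proj₂ (≈-typed e)) r)
                    (≈-sound e' (proj₂ (≈-typed e)) D' (RelatedEnv-trans (RelatedEnv-sym r) r))
  ≈-sound (≈lam e) (⊢lam D) (⊢lam D') r x y x~y = ≈-sound e D D' (x~y , r)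
  ≈-sound (≈app e e') (⊢app D E) (⊢app D' E') r
    with ⊢-type-unique E (proj₁ (≈-typed e')) | ⊢-type-unique E' (proj₂ (≈-typed e'))
  ... | refl | refl = ≈-sound e D D' r _ _ (≈-sound e' E E' r)
  ≈-sound (≈β _ _) (⊢app (⊢lam D) U) D' {ρ} {σ} r =
    Related-sym _ (eval-substAt [] refl D U D' []E []E σ ρ (eval U ρ) tt (RelatedEnv-sym r)
                                (eval-related U U (RelatedEnv-sym r)))
  ≈-sound (≈η _) D (⊢lam (⊢app D₀ (⊢var here))) {ρ} {σ} r x y x~y =
    Related-sym _ (eval-shift [] refl D D₀ []E []E y σ ρ tt (RelatedEnv-sym r) y x (Related-sym _ x~y))

∋-map : ∀ (f : Ty → Ty) {Γ i A} → Γ ∋ i ∶ A → map f Γ ∋ i ∶ f A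
∋-map f here      = here
∋-map f (there l) = there (∋-map f l)

⟦/p⟧-typed : ∀ σ {Γ t A} → nothing ∣ Γ ⊢ t ∶ A → nothing ∣ map (_[ σ /p]) Γ ⊢ t ⟦ σ /p⟧ ∶ (A [ σ /p])
⟦/p⟧-typed σ (⊢var l)   = ⊢var (∋-map _ l)
⟦/p⟧-typed σ (⊢lam D)   = ⊢lam (⟦/p⟧-typed σ D)
⟦/p⟧-typed σ (⊢app D E) = ⊢app (⟦/p⟧-typed σ D) (⟦/p⟧-typed σ E)

shift-⟦/p⟧ : ∀ c t σ → shift c (t ⟦ σ /p⟧) ≡ (shift c t) ⟦ σ /p⟧
shift-⟦/p⟧ c (var j) σ with shift-var-view c j
... | inj₁ (_ , e) rewrite e = refl
... | inj₂ (_ , e) rewrite e = refl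
shift-⟦/p⟧ c (lam A t) σ = cong (lam _) (shift-⟦/p⟧ (suc c) t σ)
shift-⟦/p⟧ c (app t u) σ = cong₂ app (shift-⟦/p⟧ c t σ) (shift-⟦/p⟧ c u σ)
shift-⟦/p⟧ c hole      σ = refl

substAt-⟦/p⟧ : ∀ k u t σ → substAt k (u ⟦ σ /p⟧) (t ⟦ σ /p⟧) ≡ (substAt k u t) ⟦ σ /p⟧
substAt-⟦/p⟧ k u (var j) σ with compare j k
... | less _ _    = refl
... | equal _     = refl
... | greater _ _ = refl
substAt-⟦/p⟧ k u (lam A t) σ rewrite shift-⟦/p⟧ 0 u σ = cong (lam _) (substAt-⟦/p⟧ (suc k) (shift 0 u) t σ)
substAt-⟦/p⟧ k u (app t v) σ = cong₂ app (substAt-⟦/p⟧ k u t σ) (substAt-⟦/p⟧ k u v σ)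
substAt-⟦/p⟧ k u hole      σ = refl

≈-⟦/p⟧ : ∀ σ {Γ t t' A} → Γ ⊢ t ≈ t' ∶ A → map (_[ σ /p]) Γ ⊢ t ⟦ σ /p⟧ ≈ t' ⟦ σ /p⟧ ∶ (A [ σ /p])
≈-⟦/p⟧ σ (≈refl D)     = ≈refl (⟦/p⟧-typed σ D)
≈-⟦/p⟧ σ (≈sym e)      = ≈sym (≈-⟦/p⟧ σ e)
≈-⟦/p⟧ σ (≈trans e e') = ≈trans (≈-⟦/p⟧ σ e) (≈-⟦/p⟧ σ e')
≈-⟦/p⟧ σ (≈lam e)      = ≈lam (≈-⟦/p⟧ σ e)
≈-⟦/p⟧ σ (≈app e e')   = ≈app (≈-⟦/p⟧ σ e) (≈-⟦/p⟧ σ e')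
≈-⟦/p⟧ σ {Γ} (≈β {t = t} {u = u} {A = A} {B = B} D U) =
  subst (λ r → map (_[ σ /p]) Γ ⊢ app (lam (A [ σ /p]) (t ⟦ σ /p⟧)) (u ⟦ σ /p⟧) ≈ r ∶ (B [ σ /p]))
        (substAt-⟦/p⟧ 0 u t σ) (≈β (⟦/p⟧-typed σ D) (⟦/p⟧-typed σ U))
≈-⟦/p⟧ σ {Γ} (≈η {t = t} {A = A} {B = B} D) =
  subst (λ r → map (_[ σ /p]) Γ ⊢ t ⟦ σ /p⟧ ≈ lam (A [ σ /p]) (app r (var 0)) ∶ ((A ⊸ B) [ σ /p]))
        (shift-⟦/p⟧ 0 t σ) (≈η (⟦/p⟧-typed σ D))

occ-⟦/p⟧ : ∀ i t σ → occ i (t ⟦ σ /p⟧) ≡ occ i t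
occ-⟦/p⟧ i (var j)   σ = refl
occ-⟦/p⟧ i (lam A t) σ = occ-⟦/p⟧ (suc i) t σ
occ-⟦/p⟧ i (app t u) σ = cong₂ _+_ (occ-⟦/p⟧ i t σ) (occ-⟦/p⟧ i u σ)
occ-⟦/p⟧ i hole      σ = refl

Linear-⟦/p⟧ : ∀ t σ → Linear t → Linear (t ⟦ σ /p⟧)
Linear-⟦/p⟧ (var j)   σ L        = L
Linear-⟦/p⟧ (lam A t) σ (o , L)  = trans (occ-⟦/p⟧ 0 t σ) o , Linear-⟦/p⟧ t σ L
Linear-⟦/p⟧ (app t u) σ (L₁ , L₂) = Linear-⟦/p⟧ t σ L₁ , Linear-⟦/p⟧ u σ L₂
Linear-⟦/p⟧ hole      σ L        = L

∋-++ : ∀ {Γ i A} Γ′ → Γ ∋ i ∶ A → (Γ ++ Γ′) ∋ i ∶ A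
∋-++ Γ′ here      = here
∋-++ Γ′ (there l) = there (∋-++ Γ′ l)

⊢-++ : ∀ {Γ t A} Γ′ → nothing ∣ Γ ⊢ t ∶ A → nothing ∣ (Γ ++ Γ′) ⊢ t ∶ A
⊢-++ Γ′ (⊢var l)   = ⊢var (∋-++ Γ′ l)
⊢-++ Γ′ (⊢lam D)   = ⊢lam (⊢-++ Γ′ D)
⊢-++ Γ′ (⊢app D E) = ⊢app (⊢-++ Γ′ D) (⊢-++ Γ′ E)

≈-++ : ∀ {Γ t t' A} Γ′ → Γ ⊢ t ≈ t' ∶ A → (Γ ++ Γ′) ⊢ t ≈ t' ∶ A
≈-++ Γ′ (≈refl D)     = ≈refl (⊢-++ Γ′ D)
≈-++ Γ′ (≈sym e)      = ≈sym (≈-++ Γ′ e)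
≈-++ Γ′ (≈trans e e') = ≈trans (≈-++ Γ′ e) (≈-++ Γ′ e')
≈-++ Γ′ (≈lam e)      = ≈lam (≈-++ Γ′ e)
≈-++ Γ′ (≈app e e')   = ≈app (≈-++ Γ′ e) (≈-++ Γ′ e')
≈-++ Γ′ (≈β D U)      = ≈β (⊢-++ Γ′ D) (⊢-++ Γ′ U)
≈-++ Γ′ (≈η D)        = ≈η (⊢-++ Γ′ D)

∋⇒< : ∀ {Γ i A} → Γ ∋ i ∶ A → i < length Γ
∋⇒< here      = s≤s z≤n
∋⇒< (there l) = s≤s (∋⇒< l)

occ-beyond-context : ∀ {Γ t A} → nothing ∣ Γ ⊢ t ∶ A → ∀ j → length Γ ≤ j → occ j t ≡ 0
occ-beyond-context (⊢var {i = i} l) j ≤j = occ-var-other j i (>⇒≢ (≤-trans (∋⇒< l) ≤j))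
occ-beyond-context (⊢lam D)         j ≤j = occ-beyond-context D (suc j) (s≤s ≤j)
occ-beyond-context (⊢app D E)       j ≤j = cong₂ _+_ (occ-beyond-context D j ≤j) (occ-beyond-context E j ≤j)

plug-holeless : ∀ t X → holes t ≡ 0 → plug t X ≡ t
plug-holeless (var i)   X _ = refl
plug-holeless (lam A t) X h = cong (lam A) (plug-holeless t X h)
plug-holeless (app t s) X h = cong₂ app (plug-holeless t X (m+n≡0⇒m≡0 _ h)) (plug-holeless s X (m+n≡0⇒n≡0 (holes t) h))

occ-plug : ∀ C X → (∀ j → occ j X ≡ 0) → ∀ i → occ i (plug C X) ≡ occ i C
occ-plug (var j)   X closed i = refl
occ-plug (lam A t) X closed i = occ-plug t X closed (suc i)
occ-plug (app t u) X closed i = cong₂ _+_ (occ-plug t X closed i) (occ-plug u X closed i)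
occ-plug hole      X closed i = closed i

Linear-plug : ∀ C X → Linear C → Linear X → (∀ j → occ j X ≡ 0) → Linear (plug C X)
Linear-plug (var j)   X LC        LX closed = LC
Linear-plug (lam A t) X (o , LC)  LX closed = trans (occ-plug t X closed 0) o , Linear-plug t X LC LX closed
Linear-plug (app t u) X (L₁ , L₂) LX closed = Linear-plug t X L₁ LX closed , Linear-plug u X L₂ LX closed
Linear-plug hole      X LC        LX closed = LX

infix  22 _⊸^_
infixr 21 _⊸*_

_⊸^_ : Ty → ℕ → Ty
σ ⊸^ zero  = σ
σ ⊸^ suc k = σ ⊸ σ ⊸^ k

_⊸*_ : List Ty → Ty → Ty
[]       ⊸* B = B
(A ∷ As) ⊸* B = A ⊸ As ⊸* B

shape : List ℕ → Ty → Ty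
shape ks σ = map (σ ⊸^_) ks ⊸* σ

⊸-injective : ∀ {A B C D} → A ⊸ B ≡ C ⊸ D → A ≡ C × B ≡ D
⊸-injective refl = refl , refl

A≢A⊸B : ∀ {A B} → ¬ A ≡ A ⊸ B
A≢A⊸B {A ⊸ A'} e = A≢A⊸B (proj₁ (⊸-injective e))

⊸^-injective : ∀ σ {k k'} → σ ⊸^ k ≡ σ ⊸^ k' → k ≡ k'
⊸^-injective σ {zero}  {zero}   _ = refl
⊸^-injective σ {zero}  {suc k'} e = ⊥-elim (A≢A⊸B e)
⊸^-injective σ {suc k} {zero}   e = ⊥-elim (A≢A⊸B (sym e))
⊸^-injective σ {suc k} {suc k'} e = cong suc (⊸^-injective σ (proj₂ (⊸-injective e)))

⊸^-⟦/p⟧ : ∀ σ k → (p ⊸^ k) [ σ /p] ≡ σ ⊸^ k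
⊸^-⟦/p⟧ σ zero    = refl
⊸^-⟦/p⟧ σ (suc k) = cong (σ ⊸_) (⊸^-⟦/p⟧ σ k)

map-⊸^-⟦/p⟧ : ∀ σ ks → map (_[ σ /p]) (map (p ⊸^_) ks) ≡ map (σ ⊸^_) ks
map-⊸^-⟦/p⟧ σ []       = refl
map-⊸^-⟦/p⟧ σ (k ∷ ks) = cong₂ _∷_ (⊸^-⟦/p⟧ σ k) (map-⊸^-⟦/p⟧ σ ks)

shape-⟦/p⟧ : ∀ σ ks → (shape ks p) [ σ /p] ≡ shape ks σ
shape-⟦/p⟧ σ []       = refl
shape-⟦/p⟧ σ (k ∷ ks) = cong₂ _⊸_ (⊸^-⟦/p⟧ σ k) (shape-⟦/p⟧ σ ks)

order≥1 : ∀ A → 1 ≤ order A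
order≥1 p       = s≤s z≤n
order≥1 (A ⊸ B) = ≤-trans (s≤s z≤n) (m≤m⊔n (suc (order A)) (order B))

order≤2⇒power : ∀ A → order A ≤ 2 → Σ ℕ (λ k → A ≡ p ⊸^ k)
order≤2⇒power p _ = zero , refl
order≤2⇒power (p ⊸ B) le with order≤2⇒power B (m⊔n≤o⇒n≤o 2 (order B) le)
... | k , refl = suc k , refl
order≤2⇒power ((A₁ ⊸ A₂) ⊸ B) le =
  ⊥-elim (<-irrefl refl (≤-trans (s≤s (s≤s (order≥1 A₁)))
                                 (≤-trans (s≤s (m≤m⊔n (suc (order A₁)) (order A₂)))
                                          (m⊔n≤o⇒m≤o (suc (order (A₁ ⊸ A₂))) (order B) le))))

order<4⇒shape : ∀ A → order A < 4 → Σ (List ℕ) (λ ks → A ≡ shape ks p)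
order<4⇒shape p _ = [] , refl
order<4⇒shape (A ⊸ B) (s≤s le)
  with order≤2⇒power A (≤-pred (m⊔n≤o⇒m≤o (suc (order A)) (order B) le))
     | order<4⇒shape B (s≤s (m⊔n≤o⇒n≤o (suc (order A)) (order B) le))
... | k , refl | ks , refl = k ∷ ks , refl

lams : List Ty → Tm → Tm
lams []       b = b
lams (A ∷ As) b = lam A (lams As b)

lams-typed : ∀ {H} As {Γ b B} → H ∣ (As ʳ++ Γ) ⊢ b ∶ B → H ∣ Γ ⊢ lams As b ∶ (As ⊸* B)
lams-typed []       D = D
lams-typed (A ∷ As) D = ⊢lam (lams-typed As D)

lams-cong : ∀ As {Γ b b' B} → (As ʳ++ Γ) ⊢ b ≈ b' ∶ B → Γ ⊢ lams As b ≈ lams As b' ∶ (As ⊸* B)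
lams-cong []       e = e
lams-cong (A ∷ As) e = ≈lam (lams-cong As e)

lams-⟦/p⟧ : ∀ σ As b → (lams As b) ⟦ σ /p⟧ ≡ lams (map (_[ σ /p]) As) (b ⟦ σ /p⟧)
lams-⟦/p⟧ σ []       b = refl
lams-⟦/p⟧ σ (A ∷ As) b = cong (lam _) (lams-⟦/p⟧ σ As b)

η-body : List Ty → Tm → Tm
η-body []       t = t
η-body (A ∷ As) t = η-body As (app (shift 0 t) (var 0))

η-body-typed : ∀ As {Γ t B} → nothing ∣ Γ ⊢ t ∶ (As ⊸* B) → nothing ∣ (As ʳ++ Γ) ⊢ η-body As t ∶ B
η-body-typed []       D = D
η-body-typed (A ∷ As) D = η-body-typed As (⊢app (weaken₀ A D) (⊢var here))

η-expand : ∀ As {Γ t B} → nothing ∣ Γ ⊢ t ∶ (As ⊸* B) → Γ ⊢ t ≈ lams As (η-body As t) ∶ (As ⊸* B)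
η-expand []       D = ≈refl D
η-expand (A ∷ As) D = ≈trans (≈η D) (≈lam (η-expand As (⊢app (weaken₀ A D) (⊢var here))))

Linear-η-body : ∀ As t → Linear t → Linear (η-body As t)
Linear-η-body []       t L = L
Linear-η-body (A ∷ As) t L = Linear-η-body As _ (Linear-shift 0 t L , tt)

occ-η-body-outer : ∀ As t j → occ (length As + j) (η-body As t) ≡ occ j t
occ-η-body-outer []       t j = refl
occ-η-body-outer (A ∷ As) t j = begin
  occ (suc (length As + j)) (η-body As t')  ≡⟨ cong (λ i → occ i (η-body As t')) (sym (+-suc (length As) j)) ⟩
  occ (length As + suc j) (η-body As t')    ≡⟨ occ-η-body-outer As t' (suc j) ⟩
  occ (suc j) (shift 0 t) + occ (suc j) (var 0)
                                            ≡⟨ cong₂ _+_ (occ-shift-above 0 j t z≤n) (occ-var-other (suc j) 0 (λ ())) ⟩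
  occ j t + 0                               ≡⟨ +-identityʳ _ ⟩
  occ j t                                   ∎
  where
  open ≡-Reasoning
  t' = app (shift 0 t) (var 0)

occ-η-body-bound : ∀ As t i → i < length As → occ i (η-body As t) ≡ 1
occ-η-body-bound (A ∷ As) t i (s≤s i≤) with m≤n⇒m<n∨m≡n i≤
... | inj₁ i< = occ-η-body-bound As _ i i<
... | inj₂ refl = begin
  occ (length As) (η-body As t')       ≡⟨ cong (λ i → occ i (η-body As t')) (sym (+-identityʳ _)) ⟩
  occ (length As + 0) (η-body As t')   ≡⟨ occ-η-body-outer As t' 0 ⟩
  occ 0 (shift 0 t) + occ 0 (var 0)    ≡⟨ cong₂ _+_ (occ-shift-at 0 t) (occ-var-self 0) ⟩
  1                                    ∎
  where
  open ≡-Reasoning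
  t' = app (shift 0 t) (var 0)

-- First-order trees: the bodies of η-long normal forms of order < 4

data Tree : Set where
  node : ℕ → List Tree → Tree

mutual
  embed : Tree → Tm
  embed (node i ts) = embedSpine (var i) ts

  embedSpine : Tm → List Tree → Tm
  embedSpine h []       = h
  embedSpine h (t ∷ ts) = embedSpine (app h (embed t)) ts

lookup? : List ℕ → ℕ → Maybe ℕ
lookup? []      _       = nothing
lookup? (k ∷ G) zero    = just k
lookup? (k ∷ G) (suc i) = lookup? G i

lookup?⇒< : ∀ G i {k} → lookup? G i ≡ just k → i < length G
lookup?⇒< (_ ∷ G) zero    _ = s≤s z≤n
lookup?⇒< (_ ∷ G) (suc i) e = s≤s (lookup?⇒< G i e)

mutual
  Saturated : List ℕ → Tree → Set
  Saturated G (node i ts) = lookup? G i ≡ just (length ts) × Saturated* G ts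

  Saturated* : List ℕ → List Tree → Set
  Saturated* G []       = ⊤
  Saturated* G (t ∷ ts) = Saturated G t × Saturated* G ts

embedSpine-snoc : ∀ h ts T → embedSpine h (ts ++ T ∷ []) ≡ app (embedSpine h ts) (embed T)
embedSpine-snoc h []       T = refl
embedSpine-snoc h (t ∷ ts) T = embedSpine-snoc (app h (embed t)) ts T

Saturated*-snoc : ∀ G ts T → Saturated* G ts → Saturated G T → Saturated* G (ts ++ T ∷ [])
Saturated*-snoc G []       T _         sT = sT , tt
Saturated*-snoc G (t ∷ ts) T (st , sts) sT = st , Saturated*-snoc G ts T sts sT

embed-⟦/p⟧ : ∀ σ T → (embed T) ⟦ σ /p⟧ ≡ embed T
embedSpine-⟦/p⟧ : ∀ σ h ts → h ⟦ σ /p⟧ ≡ h → (embedSpine h ts) ⟦ σ /p⟧ ≡ embedSpine h ts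
embed-⟦/p⟧ σ (node i ts) = embedSpine-⟦/p⟧ σ (var i) ts refl
embedSpine-⟦/p⟧ σ h []       e = e
embedSpine-⟦/p⟧ σ h (t ∷ ts) e = embedSpine-⟦/p⟧ σ (app h (embed t)) ts (cong₂ app e (embed-⟦/p⟧ σ t))

∋-power : ∀ σ G {i B} → map (σ ⊸^_) G ∋ i ∶ B → Σ ℕ (λ k → lookup? G i ≡ just k × B ≡ σ ⊸^ k)
∋-power σ (k ∷ G) here      = k , refl , refl
∋-power σ (k ∷ G) (there l) = ∋-power σ G l

record Spine (G : List ℕ) (t : Tm) (B : Ty) : Set where
  constructor spine
  field
    head      : ℕ
    args      : List Tree
    remaining : ℕ
    type≡     : B ≡ p ⊸^ remaining
    arity≡    : lookup? G head ≡ just (length args + remaining)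
    saturated : Saturated* G args
    term≡     : t ≡ embedSpine (var head) args

mutual
  neutral⇒spine : ∀ G {t B} → Ne t → nothing ∣ map (p ⊸^_) G ⊢ t ∶ B → Spine G t B
  neutral⇒spine G nvar (⊢var l) with ∋-power p G l
  ... | k , arity , type = spine _ [] k type arity tt refl
  neutral⇒spine G (napp ne nf) (⊢app D E) with neutral⇒spine G ne D
  ... | spine i ts zero () _ _ _
  ... | spine i ts (suc m) refl arity sts refl with normal⇒tree G nf E
  ...   | T , sT , refl =
    spine i (ts ++ T ∷ []) m refl
          (trans arity (cong just (trans (sym (+-assoc (length ts) 1 m)) (cong (_+ m) (sym (length-++ ts))))))
          (Saturated*-snoc G ts T sts sT) (sym (embedSpine-snoc (var i) ts T))

  normal⇒tree : ∀ G {t} → Nf t → nothing ∣ map (p ⊸^_) G ⊢ t ∶ p → Σ Tree λ T → Saturated G T × t ≡ embed T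
  normal⇒tree G (nne ne) D with neutral⇒spine G ne D
  ... | spine i ts m type arity sts t≡ with ⊸^-injective p {m} {0} (sym type)
  ...   | refl = node i ts , (trans arity (cong just (+-identityʳ _)) , sts) , t≡

record CanonicalForm (ks : List ℕ) (Θ : Tm) : Set where
  field
    tree       : Tree
    saturated  : Saturated (reverse ks) tree
    ≈tree      : [] ⊢ Θ ≈ lams (map (p ⊸^_) ks) (embed tree) ∶ shape ks p
    linear     : ∀ i → i < length ks → occ i (embed tree) ≡ 1

open CanonicalForm

canonicalForm : ∀ ks Θ → nothing ∣ [] ⊢ Θ ∶ shape ks p → Linear Θ → CanonicalForm ks Θ
canonicalForm ks Θ D L with normalise (η-body As Θ) (η-body-typed As D) (Linear-η-body As Θ L)
  where As = map (p ⊸^_) ks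
... | normalForm b b≈ nb Db _ ob _
  with normal⇒tree (reverse ks) nb (subst (λ Γ → nothing ∣ Γ ⊢ b ∶ p) (sym (map-ʳ++ (p ⊸^_) ks)) Db)
...   | T , sT , refl = record
  { tree      = T
  ; saturated = sT
  ; ≈tree     = ≈trans (η-expand As D) (lams-cong As b≈)
  ; linear    = λ i i< → trans (ob i) (occ-η-body-bound As Θ i (subst (i <_) (sym (length-map (p ⊸^_) ks)) i<))
  }
  where As = map (p ⊸^_) ks

mutual
  preorder : Tree → List ℕ → List ℕ
  preorder (node i ts) r = i ∷ preorder* ts r

  preorder* : List Tree → List ℕ → List ℕ
  preorder* []       r = r
  preorder* (t ∷ ts) r = preorder t (preorder* ts r)

mutual
  preorder-injective : ∀ G T₁ T₂ r₁ r₂ → Saturated G T₁ → Saturated G T₂ →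
                       preorder T₁ r₁ ≡ preorder T₂ r₂ → T₁ ≡ T₂ × r₁ ≡ r₂
  preorder-injective G (node i ts₁) (node j ts₂) r₁ r₂ (a₁ , s₁) (a₂ , s₂) e with ∷-injective e
  ... | refl , e' with preorder*-injective G ts₁ ts₂ r₁ r₂ s₁ s₂ (just-injective (trans (sym a₁) a₂)) e'
  ...   | refl , refl = refl , refl

  preorder*-injective : ∀ G ts₁ ts₂ r₁ r₂ → Saturated* G ts₁ → Saturated* G ts₂ → length ts₁ ≡ length ts₂ →
                        preorder* ts₁ r₁ ≡ preorder* ts₂ r₂ → ts₁ ≡ ts₂ × r₁ ≡ r₂
  preorder*-injective G []         []         r₁ r₂ _          _          _ e = refl , e
  preorder*-injective G (t₁ ∷ ts₁) (t₂ ∷ ts₂) r₁ r₂ (s₁ , ss₁) (s₂ , ss₂) l e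
    with preorder-injective G t₁ t₂ _ _ s₁ s₂ e
  ... | refl , e' with preorder*-injective G ts₁ ts₂ r₁ r₂ ss₁ ss₂ (suc-injective l) e'
  ...   | refl , refl = refl , refl

preorder-++ : ∀ T r → preorder T r ≡ preorder T [] ++ r
preorder*-++ : ∀ ts r → preorder* ts r ≡ preorder* ts [] ++ r
preorder-++ (node i ts) r = cong (i ∷_) (preorder*-++ ts r)
preorder*-++ []       r = refl
preorder*-++ (t ∷ ts) r = begin
  preorder t (preorder* ts r)              ≡⟨ preorder-++ t (preorder* ts r) ⟩
  preorder t [] ++ preorder* ts r          ≡⟨ cong (preorder t [] ++_) (preorder*-++ ts r) ⟩
  preorder t [] ++ (preorder* ts [] ++ r)  ≡⟨ sym (++-assoc (preorder t []) (preorder* ts []) r) ⟩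
  (preorder t [] ++ preorder* ts []) ++ r  ≡⟨ cong (_++ r) (sym (preorder-++ t (preorder* ts []))) ⟩
  preorder t (preorder* ts []) ++ r        ∎
  where open ≡-Reasoning

mutual
  preorder-bounded : ∀ G T r → Saturated G T → All (_< length G) r → All (_< length G) (preorder T r)
  preorder-bounded G (node i ts) r (a , sts) r< = lookup?⇒< G i a ∷ preorder*-bounded G ts r sts r<

  preorder*-bounded : ∀ G ts r → Saturated* G ts → All (_< length G) r → All (_< length G) (preorder* ts r)
  preorder*-bounded G []       r _          r< = r<
  preorder*-bounded G (t ∷ ts) r (st , sts) r< = preorder-bounded G t (preorder* ts r) st (preorder*-bounded G ts r sts r<)

count : ℕ → List ℕ → ℕ
count i []       = 0
count i (x ∷ xs) with i ≟ x
... | yes _ = suc (count i xs)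
... | no _  = count i xs

count-∷-≡ : ∀ x L → count x (x ∷ L) ≡ suc (count x L)
count-∷-≡ x L with x ≟ x
... | yes _  = refl
... | no x≢x = ⊥-elim (x≢x refl)

count-∷-≢ : ∀ i x L → ¬ i ≡ x → count i (x ∷ L) ≡ count i L
count-∷-≢ i x L i≢x with i ≟ x
... | yes i≡x = ⊥-elim (i≢x i≡x)
... | no _    = refl

count-∷-pred : ∀ x L {n} → count x (x ∷ L) ≡ suc n → count x L ≡ n
count-∷-pred x L e = suc-injective (trans (sym (count-∷-≡ x L)) e)

count-∷-skip : ∀ {i} x L {n} → ¬ x ≡ i → count i (x ∷ L) ≡ n → count i L ≡ n
count-∷-skip {i} x L x≢i e = trans (sym (count-∷-≢ i x L (≢-sym x≢i))) e

≡suc⇒≥1 : ∀ {n m} → n ≡ suc m → 1 ≤ n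
≡suc⇒≥1 refl = s≤s z≤n

count-var : ∀ i j r → count i (j ∷ r) ≡ occ i (var j) + count i r
count-var i j r with i ≟ j
... | yes refl rewrite occ-var-self i         = refl
... | no i≢j   rewrite occ-var-other i j i≢j = refl

mutual
  count-preorder : ∀ i T r → count i (preorder T r) ≡ occ i (embed T) + count i r
  count-preorder i (node j ts) r = trans (count-var i j (preorder* ts r)) (count-preorder* i (var j) ts r)

  count-preorder* : ∀ i h ts r → occ i h + count i (preorder* ts r) ≡ occ i (embedSpine h ts) + count i r
  count-preorder* i h []       r = refl
  count-preorder* i h (t ∷ ts) r =
    trans (cong (occ i h +_) (count-preorder i t (preorder* ts r)))
          (trans (sym (+-assoc (occ i h) _ _)) (count-preorder* i (app h (embed t)) ts r))

count-beyond : ∀ {n} i L → All (_< n) L → n ≤ i → count i L ≡ 0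
count-beyond i []       []          _   = refl
count-beyond i (x ∷ xs) (x< ∷ xs<) n≤i with i ≟ x
... | yes refl = ⊥-elim (<-irrefl refl (≤-trans x< n≤i))
... | no _     = count-beyond i xs xs< n≤i

count-tail : ∀ x L₁ L₂ → (∀ i → count i (x ∷ L₁) ≡ count i (x ∷ L₂)) → ∀ i → count i L₁ ≡ count i L₂
count-tail x L₁ L₂ same i with i ≟ x
... | yes refl = count-∷-pred i L₁ (trans (same i) (count-∷-≡ i L₂))
... | no i≢x   = count-∷-skip x L₁ (≢-sym i≢x) (trans (same i) (count-∷-≢ i x L₂ i≢x))

data Before (u v : ℕ) : List ℕ → Set where
  before-here  : ∀ {xs}   → 1 ≤ count v xs → Before u v (u ∷ xs)
  before-there : ∀ {y xs} → Before u v xs  → Before u v (y ∷ xs)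

Before⇒countˡ : ∀ {u v L} → Before u v L → 1 ≤ count u L
Before⇒countˡ {u} {L = _ ∷ xs} (before-here _) = ≡suc⇒≥1 (count-∷-≡ u xs)
Before⇒countˡ {u} {L = y ∷ xs} (before-there b) with u ≟ y
... | yes _ = s≤s z≤n
... | no _  = Before⇒countˡ b

Before⇒countʳ : ∀ {u v L} → Before u v L → 1 ≤ count v L
Before⇒countʳ {v = v} {L = y ∷ xs} b with v ≟ y
... | yes _ = s≤s z≤n
Before⇒countʳ (before-here v∈)  | no _ = v∈
Before⇒countʳ (before-there b) | no _ = Before⇒countʳ b

inversion : ∀ L₁ L₂ → (∀ i → count i L₁ ≡ count i L₂) → ¬ L₁ ≡ L₂ →
            Σ ℕ λ u → Σ ℕ λ v → ¬ u ≡ v × Before u v L₁ × Before v u L₂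
inversion []       []       _    L₁≢L₂ = ⊥-elim (L₁≢L₂ refl)
inversion []       (y ∷ L₂) same _     = ⊥-elim (0≢1+n (trans (same y) (count-∷-≡ y L₂)))
inversion (x ∷ L₁) []       same _     = ⊥-elim (0≢1+n (trans (sym (same x)) (count-∷-≡ x L₁)))
inversion (x ∷ L₁) (y ∷ L₂) same L₁≢L₂ with x ≟ y
... | yes refl with inversion L₁ L₂ (count-tail x L₁ L₂ same) (λ e → L₁≢L₂ (cong (x ∷_) e))
...   | u , v , u≢v , b₁ , b₂ = u , v , u≢v , before-there b₁ , before-there b₂
inversion (x ∷ L₁) (y ∷ L₂) same L₁≢L₂ | no x≢y =
  x , y , x≢y ,
  before-here (≡suc⇒≥1 (count-∷-skip x L₁ x≢y (trans (same y) (count-∷-≡ y L₂)))) ,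
  before-here (≡suc⇒≥1 (count-∷-skip y L₂ (≢-sym x≢y) (trans (sym (same x)) (count-∷-≡ x L₁))))

module CanonicalWord {ks Θ} (cf : CanonicalForm ks Θ) where

  word : List ℕ
  word = preorder (tree cf) []

  word-bounded : All (_< length ks) word
  word-bounded = subst (λ n → All (_< n) word) (length-reverse ks)
                       (preorder-bounded (reverse ks) (tree cf) [] (saturated cf) [])

  count-word-< : ∀ i → i < length ks → count i word ≡ 1
  count-word-< i i< = trans (count-preorder i (tree cf) []) (trans (+-identityʳ _) (linear cf i i<))

  count-word-≥ : ∀ i → length ks ≤ i → count i word ≡ 0
  count-word-≥ i ≤i = count-beyond i word word-bounded ≤i

  count-word-pos : ∀ i → 1 ≤ count i word → i < length ks
  count-word-pos i pos with i <? length ks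
  ... | yes i< = i<
  ... | no i≮  = ⊥-elim (<⇒≢ pos (sym (count-word-≥ i (≮⇒≥ i≮))))

open CanonicalWord

same-counts : ∀ {ks Θ₁ Θ₂} (cf₁ : CanonicalForm ks Θ₁) (cf₂ : CanonicalForm ks Θ₂) →
              ∀ i → count i (word cf₁) ≡ count i (word cf₂)
same-counts {ks} cf₁ cf₂ i with i <? length ks
... | yes i< = trans (count-word-< cf₁ i i<) (sym (count-word-< cf₂ i i<))
... | no i≮  = trans (count-word-≥ cf₁ i (≮⇒≥ i≮)) (sym (count-word-≥ cf₂ i (≮⇒≥ i≮)))

same-word⇒≈ : ∀ {ks Θ₁ Θ₂} (cf₁ : CanonicalForm ks Θ₁) (cf₂ : CanonicalForm ks Θ₂) →
              word cf₁ ≡ word cf₂ → [] ⊢ Θ₁ ≈ Θ₂ ∶ shape ks p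
same-word⇒≈ {ks} cf₁ cf₂ w₁≡w₂
  with preorder-injective (reverse ks) (tree cf₁) (tree cf₂) [] [] (saturated cf₁) (saturated cf₂) w₁≡w₂
... | T₁≡T₂ , _ = ≈trans (≈tree cf₁)
                         (subst (λ T → [] ⊢ lams (map (p ⊸^_) ks) (embed T) ≈ _ ∶ shape ks p) (sym T₁≡T₂)
                                (≈sym (≈tree cf₂)))

module _ {X : Set} (step : ℕ → X → X) where

  run : List ℕ → X → X
  run []       s = s
  run (x ∷ xs) s = run xs (step x s)

  run-++ : ∀ xs ys s → run (xs ++ ys) s ≡ run ys (run xs s)
  run-++ []       ys s = refl
  run-++ (x ∷ xs) ys s = run-++ xs ys (step x s)

  module _ {u v : ℕ} (idle : ∀ x → ¬ x ≡ u → ¬ x ≡ v → ∀ s → step x s ≡ s) where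

    run-idle : ∀ L → count u L ≡ 0 → count v L ≡ 0 → ∀ s → run L s ≡ s
    run-idle []      _  _  s = refl
    run-idle (x ∷ L) cu cv s with x ≟ u | x ≟ v
    ... | yes refl | _        = ⊥-elim (0≢1+n (trans (sym cu) (count-∷-≡ x L)))
    ... | no _     | yes refl = ⊥-elim (0≢1+n (trans (sym cv) (count-∷-≡ x L)))
    ... | no x≢u   | no x≢v rewrite idle x x≢u x≢v s = run-idle L (count-∷-skip x L x≢u cu) (count-∷-skip x L x≢v cv) s

    run-once : ∀ L → count u L ≡ 0 → count v L ≡ 1 → ∀ s → run L s ≡ step v s
    run-once (x ∷ L) cu cv s with x ≟ u | x ≟ v
    ... | yes refl | _        = ⊥-elim (0≢1+n (trans (sym cu) (count-∷-≡ x L)))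
    ... | no x≢u   | yes refl = run-idle L (count-∷-skip x L x≢u cu) (count-∷-pred x L cv) (step x s)
    ... | no x≢u   | no x≢v rewrite idle x x≢u x≢v s = run-once L (count-∷-skip x L x≢u cu) (count-∷-skip x L x≢v cv) s

    run-before : ¬ u ≡ v → ∀ L → Before u v L → count u L ≡ 1 → count v L ≡ 1 → ∀ s → run L s ≡ step v (step u s)
    run-before u≢v (x ∷ L) (before-here _) cu cv s =
      run-once L (count-∷-pred x L cu) (count-∷-skip x L u≢v cv) (step x s)
    run-before u≢v (x ∷ L) (before-there b) cu cv s with x ≟ u | x ≟ v
    ... | yes refl | _        = ⊥-elim (<⇒≢ (Before⇒countˡ b) (sym (count-∷-pred x L cu)))
    ... | no _     | yes refl = ⊥-elim (<⇒≢ (Before⇒countʳ b) (sym (count-∷-pred x L cv)))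
    ... | no x≢u   | no x≢v rewrite idle x x≢u x≢v s =
      run-before u≢v L b (count-∷-skip x L x≢u cu) (count-∷-skip x L x≢v cv) s

Word : Set
Word = List Bool

open SetModel Word

idTm : Tm
idTm = lam p (var 0)

idTm-typed : ∀ {H Γ} → H ∣ Γ ⊢ idTm ∶ (p ⊸ p)
idTm-typed = ⊢lam (⊢var here)

-- chain k h n₁ ⋯ nₖ = λx f g. g (f (nₖ (⋯ (n₁ (h x) I I) ⋯) I I)): it performs h and then
-- n₁, …, nₖ, each read as a transformer by feeding it the identity twice; f and g occur only
-- to be used linearly.
chain : ℕ → Tm
chain zero    = lam (p ⊸ p) (lam p (lam (p ⊸ p) (lam (p ⊸ p) (app (var 0) (app (var 1) (app (var 3) (var 2)))))))
chain (suc k) = lam (p ⊸ p) (lam Nat (app (chain k) (lam p (app (app (app (var 1) (app (var 2) (var 0))) idTm) idTm))))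

chain-typed : ∀ {H Γ} k → H ∣ Γ ⊢ chain k ∶ ((p ⊸ p) ⊸ Nat ⊸^ k)
chain-typed zero =
  ⊢lam (⊢lam (⊢lam (⊢lam (⊢app (⊢var here) (⊢app (⊢var (there here))
                                                  (⊢app (⊢var (there (there (there here)))) (⊢var (there (there here)))))))))
chain-typed (suc k) =
  ⊢lam (⊢lam (⊢app (chain-typed k)
                   (⊢lam (⊢app (⊢app (⊢app (⊢var (there here)) (⊢app (⊢var (there (there here))) (⊢var here)))
                                     idTm-typed) idTm-typed))))

occ-idTm : ∀ i → occ i idTm ≡ 0
occ-idTm i = occ-var-other (suc i) 0 (λ ())

occ-chain : ∀ k i → occ i (chain k) ≡ 0
occ-chain zero i
  rewrite occ-var-other (4 + i) 0 (λ ()) | occ-var-other (4 + i) 1 (λ ())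
        | occ-var-other (4 + i) 3 (λ ()) | occ-var-other (4 + i) 2 (λ ()) = refl
occ-chain (suc k) i
  rewrite occ-chain k (2 + i) | occ-idTm (3 + i)
        | occ-var-other (3 + i) 0 (λ ()) | occ-var-other (3 + i) 1 (λ ()) | occ-var-other (3 + i) 2 (λ ()) = refl

Linear-chain : ∀ k → Linear (chain k)
Linear-chain zero = refl , refl , refl , refl , tt , tt , tt , tt
Linear-chain (suc k) rewrite occ-chain k 0 | occ-chain k 1 =
  refl , refl , Linear-chain k , refl , ((tt , (tt , tt)) , (refl , tt)) , (refl , tt)

holes-chain : ∀ k → holes (chain k) ≡ 0
holes-chain zero = refl
holes-chain (suc k) rewrite holes-chain k = refl

-- A value of type Nat ⊸^ k represents the transformer P when, applied to values representing
-- Q₁, …, Qₖ, it yields a numeral whose value at f = g = id is Qₖ ∘ ⋯ ∘ Q₁ ∘ P.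
Represents : (k : ℕ) → ⟦ Nat ⊸^ k ⟧ → (Word → Word) → Set
Represents zero    V P = ∀ s → V s id id ≡ P s
Represents (suc k) V P = ∀ n Q → Represents zero n Q → Represents k (V n) (λ s → Q (P s))

Represents-ext : ∀ k V P P' → (∀ s → P s ≡ P' s) → Represents k V P → Represents k V P'
Represents-ext zero    V P P' P≗P' VP s       = trans (VP s) (P≗P' s)
Represents-ext (suc k) V P P' P≗P' VP n Q nQ = Represents-ext k (V n) _ _ (λ s → cong Q (P≗P' s)) (VP n Q nQ)

chain-represents : ∀ {Γ} k (ρ : Env Γ) h → Represents k (eval (chain-typed k) ρ h) h
chain-represents zero    ρ h s = refl
chain-represents (suc k) ρ h n Q nQ =
  Represents-ext k _ _ _ (λ s → nQ (h s)) (chain-represents k (n ∷E h ∷E ρ) (λ z → n (h z) id id))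

arity+0 : ∀ G i {n} → lookup? G i ≡ just n → lookup? G i ≡ just (n + 0)
arity+0 G i a = trans a (cong just (sym (+-identityʳ _)))

module TreeTyping {H : Maybe Ty} {Γ : List Ty} (σ : Ty) (G : List ℕ)
                  (∋head : ∀ i k → lookup? G i ≡ just k → Γ ∋ i ∶ σ ⊸^ k) where

  mutual
    embed-typed : ∀ T → Saturated G T → H ∣ Γ ⊢ embed T ∶ σ
    embed-typed (node i ts) (a , sts) = embedSpine-typed (var i) ts 0 (⊢var (∋head i _ (arity+0 G i a))) sts

    embedSpine-typed : ∀ h ts m → H ∣ Γ ⊢ h ∶ σ ⊸^ (length ts + m) → Saturated* G ts →
                       H ∣ Γ ⊢ embedSpine h ts ∶ σ ⊸^ m
    embedSpine-typed h []       m Dh _          = Dh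
    embedSpine-typed h (t ∷ ts) m Dh (st , sts) = embedSpine-typed (app h (embed t)) ts m (⊢app Dh (embed-typed t st)) sts

module TreeSemantics {Γ : List Ty} (G : List ℕ) (∋head : ∀ i k → lookup? G i ≡ just k → Γ ∋ i ∶ Nat ⊸^ k)
                     (ρ : Env Γ) (step : ℕ → Word → Word)
                     (heads : ∀ i k (l : Γ ∋ i ∶ Nat ⊸^ k) → lookup? G i ≡ just k →
                              Represents k (lookupE l ρ) (step i)) where
  open TreeTyping {nothing} {Γ} Nat G ∋head

  mutual
    embed-represents : ∀ T (s : Saturated G T) → Represents 0 (eval (embed-typed T s) ρ) (run step (preorder T []))
    embed-represents (node i ts) (a , sts) =
      embedSpine-represents (var i) ts 0 _ sts (heads i _ (∋head i _ (arity+0 G i a)) (arity+0 G i a))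

    embedSpine-represents : ∀ h ts m (Dh : nothing ∣ Γ ⊢ h ∶ Nat ⊸^ (length ts + m)) (sts : Saturated* G ts) {P} →
                            Represents (length ts + m) (eval Dh ρ) P →
                            Represents m (eval (embedSpine-typed h ts m Dh sts) ρ) (λ s → run step (preorder* ts []) (P s))
    embedSpine-represents h []       m Dh _          hP = hP
    embedSpine-represents h (t ∷ ts) m Dh (st , sts) {P} hP =
      Represents-ext m _ _ _ (λ s → trans (sym (run-++ step (preorder t []) (preorder* ts []) (P s)))
                                          (cong (λ L → run step L (P s)) (sym (preorder-++ t (preorder* ts [])))))
        (embedSpine-represents (app h (embed t)) ts m (⊢app Dh (embed-typed t st)) sts (hP _ _ (embed-represents t st)))

apps : Tm → List Tm → Tm
apps h []       = h
apps h (m ∷ ms) = apps (app h m) ms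

data Args (H : Maybe Ty) (Γ : List Ty) : List Ty → List Tm → Set where
  []A  : Args H Γ [] []
  _∷A_ : ∀ {A As m ms} → H ∣ Γ ⊢ m ∶ A → Args H Γ As ms → Args H Γ (A ∷ As) (m ∷ ms)

apps-typed : ∀ {H Γ h As B ms} → H ∣ Γ ⊢ h ∶ (As ⊸* B) → Args H Γ As ms → H ∣ Γ ⊢ apps h ms ∶ B
apps-typed Dh []A       = Dh
apps-typed Dh (D ∷A Ds) = apps-typed (⊢app Dh D) Ds

apps-cong : ∀ {Γ h h' As B ms} → Γ ⊢ h ≈ h' ∶ (As ⊸* B) → Args nothing Γ As ms → Γ ⊢ apps h ms ≈ apps h' ms ∶ B
apps-cong e []A       = e
apps-cong e (D ∷A Ds) = apps-cong (≈app e (≈refl D)) Ds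

applyArgs : ∀ {Γ As B ms} → ⟦ As ⊸* B ⟧ → Args nothing Γ As ms → Env Γ → ⟦ B ⟧
applyArgs F []A       ρ = F
applyArgs F (D ∷A Ds) ρ = applyArgs (F (eval D ρ)) Ds ρ

eval-apps : ∀ {Γ h As B ms} (Dh : nothing ∣ Γ ⊢ h ∶ (As ⊸* B)) (Ds : Args nothing Γ As ms) ρ →
            eval (apps-typed Dh Ds) ρ ≡ applyArgs (eval Dh ρ) Ds ρ
eval-apps Dh []A       ρ = refl
eval-apps Dh (D ∷A Ds) ρ = eval-apps (⊢app Dh D) Ds ρ

extendEnv : ∀ As {Γ₀ Γ ms} → Args nothing Γ As ms → Env Γ → Env Γ₀ → Env (As ʳ++ Γ₀)
extendEnv []       []A       ρ ρ₀ = ρ₀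
extendEnv (A ∷ As) (D ∷A Ds) ρ ρ₀ = extendEnv As Ds ρ (eval D ρ ∷E ρ₀)

eval-lams : ∀ As {Γ₀ Γ b B ms} (Db : nothing ∣ (As ʳ++ Γ₀) ⊢ b ∶ B) (Ds : Args nothing Γ As ms) ρ ρ₀ →
            applyArgs (eval (lams-typed As Db) ρ₀) Ds ρ ≡ eval Db (extendEnv As Ds ρ ρ₀)
eval-lams []       Db []A       ρ ρ₀ = refl
eval-lams (A ∷ As) Db (D ∷A Ds) ρ ρ₀ = eval-lams As Db Ds ρ (eval D ρ ∷E ρ₀)

lookupE-extendEnv : ∀ As {Γ₀ Γ ms} (Ds : Args nothing Γ As ms) ρ ρ₀ {i} j {B} (l : (As ʳ++ Γ₀) ∋ i ∶ B) →
                    i ≡ length As + j → Σ (Γ₀ ∋ j ∶ B) λ l' → lookupE l (extendEnv As Ds ρ ρ₀) ≡ lookupE l' ρ₀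
lookupE-extendEnv []       []A       ρ ρ₀ j l refl = l , refl
lookupE-extendEnv (A ∷ As) (D ∷A Ds) ρ ρ₀ j l refl
  with lookupE-extendEnv As Ds ρ (eval D ρ ∷E ρ₀) (suc j) l (sym (+-suc (length As) j))
... | there l' , e = l' , e

lookup?⇒∋ : ∀ σ G {Γ′} i k → lookup? G i ≡ just k → (map (σ ⊸^_) G ++ Γ′) ∋ i ∶ σ ⊸^ k
lookup?⇒∋ σ (k ∷ G) zero    .k refl = here
lookup?⇒∋ σ (_ ∷ G) (suc i) k  e    = there (lookup?⇒∋ σ G i k e)

lookup?-ʳ++⇒∋ : ∀ σ ks G {Γ′} i k → lookup? (ks ʳ++ G) i ≡ just k →
                (map (σ ⊸^_) ks ʳ++ (map (σ ⊸^_) G ++ Γ′)) ∋ i ∶ σ ⊸^ k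
lookup?-ʳ++⇒∋ σ []        G i k e = lookup?⇒∋ σ G i k e
lookup?-ʳ++⇒∋ σ (k' ∷ ks) G i k e = lookup?-ʳ++⇒∋ σ ks (k' ∷ G) i k e

Σ< : ℕ → (ℕ → ℕ) → ℕ
Σ< zero    h = 0
Σ< (suc n) h = h n + Σ< n h

Σ<-zero : ∀ n h → (∀ x → x < n → h x ≡ 0) → Σ< n h ≡ 0
Σ<-zero zero    h _      = refl
Σ<-zero (suc n) h vanish rewrite vanish n (n<1+n n) = Σ<-zero n h (λ x x< → vanish x (m<n⇒m<1+n x<))

Σ<-indicator : ∀ n h w → w < n → h w ≡ 1 → (∀ x → ¬ x ≡ w → h x ≡ 0) → Σ< n h ≡ 1
Σ<-indicator (suc n) h w (s≤s w≤n) at-w off-w with m≤n⇒m<n∨m≡n w≤n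
... | inj₁ w<n  rewrite off-w n (>⇒≢ w<n) = Σ<-indicator n h w w<n at-w off-w
... | inj₂ refl rewrite at-w = cong suc (Σ<-zero w h (λ x x<w → off-w x (<⇒≢ x<w)))

-- Under the three binders λx f g of a numeral, g has index 0, f index 1 and x index 2.
Δ : List Ty
Δ = (p ⊸ p) ∷ (p ⊸ p) ∷ p ∷ []

δ : Word → Env Δ
δ a = (false ∷_) ∷E (true ∷_) ∷E a ∷E []E

-- true stands for f and false for g.
encodeWord : Word → Tm
encodeWord []           = var 2
encodeWord (true ∷ xs)  = app (var 1) (encodeWord xs)
encodeWord (false ∷ xs) = app (var 0) (encodeWord xs)

encodeNat : Word → Tm
encodeNat w = lam p (lam (p ⊸ p) (lam (p ⊸ p) (encodeWord w)))

AtomOrEndo : Ty → Set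
AtomOrEndo A = A ≡ p ⊎ A ≡ (p ⊸ p)

All-∋ : ∀ {P : Ty → Set} {Γ i A} → All P Γ → Γ ∋ i ∶ A → P A
All-∋ (pA ∷ _)  here      = pA
All-∋ (_ ∷ pΓ) (there l) = All-∋ pΓ l

neutral-type : ∀ {Γ h A} → All AtomOrEndo Γ → Ne h → nothing ∣ Γ ⊢ h ∶ A → AtomOrEndo A
neutral-type pΓ nvar        (⊢var l)   = All-∋ pΓ l
neutral-type pΓ (napp ne _) (⊢app D E) with neutral-type pΓ ne D
... | inj₁ ()
... | inj₂ refl = inj₁ refl

mutual
  neutral-word : ∀ {w} → Ne w → (D : nothing ∣ Δ ⊢ w ∶ p) → w ≡ encodeWord (eval D (δ []))
  neutral-word nvar                 (⊢var (there (there here)))    = refl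
  neutral-word (napp nvar nf)       (⊢app (⊢var here) E)           = cong (app (var 0)) (normal-word nf E)
  neutral-word (napp nvar nf)       (⊢app (⊢var (there here)) E)   = cong (app (var 1)) (normal-word nf E)
  neutral-word (napp nvar nf)       (⊢app (⊢var (there (there (there ())))) E)
  neutral-word (napp (napp ne _) _) (⊢app (⊢app D _) _)
    with neutral-type (inj₂ refl ∷ inj₂ refl ∷ inj₁ refl ∷ []) ne D
  ... | inj₁ ()
  ... | inj₂ ()

  normal-word : ∀ {w} → Nf w → (D : nothing ∣ Δ ⊢ w ∶ p) → w ≡ encodeWord (eval D (δ []))
  normal-word (nne ne) D = neutral-word ne D

Nat-normal-form : ∀ {t} → Nf t → (D : nothing ∣ [] ⊢ t ∶ Nat) → t ≡ encodeNat (eval D []E [] (true ∷_) (false ∷_))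
Nat-normal-form (nne ne) D with neutral-type [] ne D
... | inj₁ ()
... | inj₂ ()
Nat-normal-form (nlam (nne ne)) (⊢lam D) with neutral-type (inj₁ refl ∷ []) ne D
... | inj₁ ()
... | inj₂ ()
Nat-normal-form (nlam (nlam (nne ne))) (⊢lam (⊢lam D)) with neutral-type (inj₂ refl ∷ inj₁ refl ∷ []) ne D
... | inj₁ ()
... | inj₂ ()
Nat-normal-form (nlam (nlam (nlam nf))) (⊢lam (⊢lam (⊢lam D))) =
  cong (λ w → lam p (lam (p ⊸ p) (lam (p ⊸ p) w))) (normal-word nf D)

related-numerals-agree : ∀ {V W} → Related Nat V W → V [] (true ∷_) (false ∷_) ≡ W [] (true ∷_) (false ∷_)
related-numerals-agree V~W = V~W [] [] refl _ _ (λ _ _ → cong (true ∷_)) _ _ (λ _ _ → cong (false ∷_))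

≈encodeNat : ∀ {t} (D : nothing ∣ [] ⊢ t ∶ Nat) → Linear t →
             [] ⊢ t ≈ encodeNat (eval D []E [] (true ∷_) (false ∷_)) ∶ Nat
≈encodeNat {t} D L with normalise t D L
... | normalForm r t≈r nr Dr _ _ _ =
  subst (λ w → [] ⊢ t ≈ encodeNat w ∶ Nat) (related-numerals-agree (≈-sound (≈sym t≈r) Dr D tt))
        (subst ([] ⊢ t ≈_∶ Nat) (Nat-normal-form nr Dr) t≈r)

module Separator (u v : ℕ) where

  selector : ℕ → Tm
  selector x with x ≟ u
  ... | yes _ = var 1
  ... | no _ with x ≟ v
  ...   | yes _ = var 0
  ...   | no _  = idTm

  letter : ℕ → Word → Word
  letter x with x ≟ u
  ... | yes _ = true ∷_
  ... | no _ with x ≟ v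
  ...   | yes _ = false ∷_
  ...   | no _  = λ s → s

  selector-typed : ∀ {H} x → H ∣ Δ ⊢ selector x ∶ (p ⊸ p)
  selector-typed x with x ≟ u
  ... | yes _ = ⊢var (there here)
  ... | no _ with x ≟ v
  ...   | yes _ = ⊢var here
  ...   | no _  = idTm-typed

  chainArgs : List ℕ → List Tm
  chainArgs []       = []
  chainArgs (k ∷ ks) = app (chain k) (selector (length ks)) ∷ chainArgs ks

  chainArgs-typed : ∀ {H} ks → Args H Δ (map (Nat ⊸^_) ks) (chainArgs ks)
  chainArgs-typed []       = []A
  chainArgs-typed (k ∷ ks) = ⊢app (chain-typed k) (selector-typed (length ks)) ∷A chainArgs-typed ks

  separator : List ℕ → Tm → Tm
  separator ks X = lam p (lam (p ⊸ p) (lam (p ⊸ p) (app (app (app (apps X (chainArgs ks)) (var 2)) idTm) idTm)))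

  separator-typed : ∀ {H} ks {X} → H ∣ Δ ⊢ X ∶ shape ks Nat → H ∣ [] ⊢ separator ks X ∶ Nat
  separator-typed ks DX =
    ⊢lam (⊢lam (⊢lam (⊢app (⊢app (⊢app (apps-typed DX (chainArgs-typed ks)) (⊢var (there (there here))))
                                   idTm-typed) idTm-typed)))

  separator-cong : ∀ ks {X X'} → Δ ⊢ X ≈ X' ∶ shape ks Nat → [] ⊢ separator ks X ≈ separator ks X' ∶ Nat
  separator-cong ks e =
    ≈lam (≈lam (≈lam (≈app (≈app (≈app (apps-cong e (chainArgs-typed ks)) (≈refl (⊢var (there (there here)))))
                                 (≈refl idTm-typed)) (≈refl idTm-typed))))

  holes-selector : ∀ x → holes (selector x) ≡ 0
  holes-selector x with x ≟ u
  ... | yes _ = refl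
  ... | no _ with x ≟ v
  ...   | yes _ = refl
  ...   | no _  = refl

  holes-chainArgs : ∀ h ks → holes (apps h (chainArgs ks)) ≡ holes h
  holes-chainArgs h []       = refl
  holes-chainArgs h (k ∷ ks) rewrite holes-chainArgs (app h (app (chain k) (selector (length ks)))) ks
                                   | holes-chain k | holes-selector (length ks) = +-identityʳ _

  plug-chainArgs : ∀ h ks X → plug (apps h (chainArgs ks)) X ≡ apps (plug h X) (chainArgs ks)
  plug-chainArgs h []       X = refl
  plug-chainArgs h (k ∷ ks) X
    rewrite plug-chainArgs (app h (app (chain k) (selector (length ks)))) ks X
          | plug-holeless (chain k) X (holes-chain k)
          | plug-holeless (selector (length ks)) X (holes-selector (length ks)) = refl

  plug-separator : ∀ ks X → plug (separator ks hole) X ≡ separator ks X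
  plug-separator ks X rewrite plug-chainArgs hole ks X = refl

  holes-separator : ∀ ks → holes (separator ks hole) ≡ 1
  holes-separator ks rewrite holes-chainArgs hole ks = refl

  occ-selector-u : occ 1 (selector u) ≡ 1
  occ-selector-u with u ≟ u
  ... | yes _  = refl
  ... | no u≢u = ⊥-elim (u≢u refl)

  occ-selector-¬u : ∀ x → ¬ x ≡ u → occ 1 (selector x) ≡ 0
  occ-selector-¬u x x≢u with x ≟ u
  ... | yes x≡u = ⊥-elim (x≢u x≡u)
  ... | no _ with x ≟ v
  ...   | yes _ = refl
  ...   | no _  = refl

  occ-selector-v : ¬ u ≡ v → occ 0 (selector v) ≡ 1
  occ-selector-v u≢v with v ≟ u
  ... | yes v≡u = ⊥-elim (u≢v (sym v≡u))
  ... | no _ with v ≟ v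
  ...   | yes _  = refl
  ...   | no v≢v = ⊥-elim (v≢v refl)

  occ-selector-¬v : ∀ x → ¬ x ≡ v → occ 0 (selector x) ≡ 0
  occ-selector-¬v x x≢v with x ≟ u
  ... | yes _ = refl
  ... | no _ with x ≟ v
  ...   | yes x≡v = ⊥-elim (x≢v x≡v)
  ...   | no _    = refl

  occ-selector-x : ∀ x → occ 2 (selector x) ≡ 0
  occ-selector-x x with x ≟ u
  ... | yes _ = refl
  ... | no _ with x ≟ v
  ...   | yes _ = refl
  ...   | no _  = refl

  Linear-selector : ∀ x → Linear (selector x)
  Linear-selector x with x ≟ u
  ... | yes _ = tt
  ... | no _ with x ≟ v
  ...   | yes _ = tt
  ...   | no _  = refl , tt

  occ-chainArgs : ∀ i h ks → occ i (apps h (chainArgs ks)) ≡ occ i h + Σ< (length ks) (λ x → occ i (selector x))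
  occ-chainArgs i h []       = sym (+-identityʳ _)
  occ-chainArgs i h (k ∷ ks) rewrite occ-chainArgs i (app h (app (chain k) (selector (length ks)))) ks | occ-chain k i =
    +-assoc (occ i h) _ _

  Linear-chainArgs : ∀ h ks → Linear h → Linear (apps h (chainArgs ks))
  Linear-chainArgs h []       L = L
  Linear-chainArgs h (k ∷ ks) L =
    Linear-chainArgs (app h (app (chain k) (selector (length ks)))) ks (L , Linear-chain k , Linear-selector (length ks))

  Linear-separator : ¬ u ≡ v → ∀ ks → u < length ks → v < length ks → Linear (separator ks hole)
  Linear-separator u≢v ks u< v<
    rewrite occ-chainArgs 2 hole ks | occ-chainArgs 1 hole ks | occ-chainArgs 0 hole ks
          | Σ<-zero (length ks) _ (λ x _ → occ-selector-x x)
          | Σ<-indicator (length ks) _ u u< occ-selector-u occ-selector-¬u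
          | Σ<-indicator (length ks) _ v v< (occ-selector-v u≢v) occ-selector-¬v =
    refl , refl , refl , ((Linear-chainArgs hole ks tt , tt) , (refl , tt)) , (refl , tt)

  letter-idle : ∀ x → ¬ x ≡ u → ¬ x ≡ v → ∀ s → letter x s ≡ s
  letter-idle x x≢u x≢v s with x ≟ u
  ... | yes x≡u = ⊥-elim (x≢u x≡u)
  ... | no _ with x ≟ v
  ...   | yes x≡v = ⊥-elim (x≢v x≡v)
  ...   | no _    = refl

  letter-u : ∀ s → letter u s ≡ true ∷ s
  letter-u s with u ≟ u
  ... | yes _  = refl
  ... | no u≢u = ⊥-elim (u≢u refl)

  letter-v : ¬ u ≡ v → ∀ s → letter v s ≡ false ∷ s
  letter-v u≢v s with v ≟ u
  ... | yes v≡u = ⊥-elim (u≢v (sym v≡u))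
  ... | no _ with v ≟ v
  ...   | yes _  = refl
  ...   | no v≢v = ⊥-elim (v≢v refl)

  eval-selector : ∀ x a → eval (selector-typed x) (δ a) ≡ letter x
  eval-selector x a with x ≟ u
  ... | yes _ = refl
  ... | no _ with x ≟ v
  ...   | yes _ = refl
  ...   | no _  = refl

  chainEnv-represents : ∀ ks {Γ₀} (ρ₀ : Env Γ₀) a i k (l : (map (Nat ⊸^_) ks ʳ++ Γ₀) ∋ i ∶ Nat ⊸^ k) →
                        i < length ks →
                        Represents k (lookupE l (extendEnv (map (Nat ⊸^_) ks) (chainArgs-typed ks) (δ a) ρ₀)) (letter i)
  chainEnv-represents (k' ∷ ks) ρ₀ a i k l (s≤s i≤) with m≤n⇒m<n∨m≡n i≤
  ... | inj₁ i< = chainEnv-represents ks _ a i k l i<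
  ... | inj₂ refl
    with lookupE-extendEnv (map (Nat ⊸^_) ks) (chainArgs-typed ks) (δ a)
                           (eval (⊢app (chain-typed k') (selector-typed (length ks))) (δ a) ∷E ρ₀) 0 l
                           (sym (trans (+-identityʳ _) (length-map (Nat ⊸^_) ks)))
  ...   | l' , e with ⊸^-injective Nat (∋-type-unique l' here)
  ...     | refl with ∋-irrelevant l' here
  ...       | refl = subst (λ V → Represents k V (letter (length ks))) (sym e)
                           (subst (Represents k (eval (chain-typed k) (δ a) selected)) (eval-selector (length ks) a)
                                  (chain-represents k (δ a) selected))
    where selected = eval (selector-typed (length ks)) (δ a)

  separator-value : ∀ ks T (s : Saturated (reverse ks) T) →
    let open TreeTyping {nothing} {map (Nat ⊸^_) ks ʳ++ Δ} Nat (reverse ks) (lookup?-ʳ++⇒∋ Nat ks []) in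
    eval (separator-typed ks (lams-typed (map (Nat ⊸^_) ks) (embed-typed T s))) []E [] (true ∷_) (false ∷_)
      ≡ run letter (preorder T []) []
  separator-value ks T s = begin
    eval (apps-typed DX Ds) (δ []) [] id id
      ≡⟨ cong (λ V → V [] id id) (eval-apps DX Ds (δ [])) ⟩
    applyArgs (eval DX (δ [])) Ds (δ []) [] id id
      ≡⟨ cong (λ V → V [] id id) (eval-lams As (embed-typed T s) Ds (δ []) (δ [])) ⟩
    eval (embed-typed T s) ρ [] id id
      ≡⟨ embed-represents T s [] ⟩
    run letter (preorder T []) []
      ∎
    where
    open ≡-Reasoning
    As = map (Nat ⊸^_) ks
    ∋head = lookup?-ʳ++⇒∋ Nat ks [] {Δ}
    open TreeTyping {nothing} {As ʳ++ Δ} Nat (reverse ks) ∋head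
    Ds = chainArgs-typed ks
    DX = lams-typed As (embed-typed T s)
    ρ = extendEnv As Ds (δ []) (δ [])
    heads : ∀ i k (l : (As ʳ++ Δ) ∋ i ∶ Nat ⊸^ k) → lookup? (reverse ks) i ≡ just k → Represents k (lookupE l ρ) (letter i)
    heads i k l a = chainEnv-represents ks (δ []) [] i k l (subst (i <_) (length-reverse ks) (lookup?⇒< (reverse ks) i a))
    open TreeSemantics (reverse ks) ∋head ρ letter heads

  plug-separator-≈ : ∀ ks Θ → nothing ∣ [] ⊢ Θ ∶ shape ks p → Linear Θ → Linear (separator ks hole) →
                     (cf : CanonicalForm ks Θ) →
                     [] ⊢ plug (separator ks hole) (Θ ⟦ Nat /p⟧) ≈ encodeNat (run letter (word cf) []) ∶ Nat
  plug-separator-≈ ks Θ D L LC cf rewrite plug-separator ks (Θ ⟦ Nat /p⟧) =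
    subst (λ w → [] ⊢ separator ks X ≈ encodeNat w ∶ Nat) value (≈encodeNat DC LX)
    where
    As = map (Nat ⊸^_) ks
    X = Θ ⟦ Nat /p⟧
    DX : nothing ∣ Δ ⊢ X ∶ shape ks Nat
    DX = ⊢-++ Δ (subst (nothing ∣ [] ⊢ X ∶_) (shape-⟦/p⟧ Nat ks) (⟦/p⟧-typed Nat D))
    DC = separator-typed ks DX
    LX : Linear (separator ks X)
    LX = subst Linear (plug-separator ks X)
               (Linear-plug (separator ks hole) X LC (Linear-⟦/p⟧ Θ Nat L)
                            (λ j → trans (occ-⟦/p⟧ j Θ Nat) (occ-beyond-context D j z≤n)))
    open TreeTyping {nothing} {As ʳ++ Δ} Nat (reverse ks) (lookup?-ʳ++⇒∋ Nat ks [])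
    N = lams As (embed (tree cf))
    DN = separator-typed ks (lams-typed As (embed-typed (tree cf) (saturated cf)))
    X≈N : Δ ⊢ X ≈ N ∶ shape ks Nat
    X≈N = ≈-++ Δ (subst₂ ([] ⊢ X ≈_∶_) (trans (lams-⟦/p⟧ Nat (map (p ⊸^_) ks) (embed (tree cf)))
                                              (cong₂ lams (map-⊸^-⟦/p⟧ Nat ks) (embed-⟦/p⟧ Nat (tree cf))))
                                       (shape-⟦/p⟧ Nat ks) (≈-⟦/p⟧ Nat (≈tree cf)))
    value : eval DC []E [] (true ∷_) (false ∷_) ≡ run letter (word cf) []
    value = trans (related-numerals-agree (≈-sound (separator-cong ks X≈N) DC DN tt))
                  (separator-value ks (tree cf) (saturated cf))

separating-context : ∀ {ks Θ₁ Θ₂ u v} →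
  nothing ∣ [] ⊢ Θ₁ ∶ shape ks p → Linear Θ₁ → nothing ∣ [] ⊢ Θ₂ ∶ shape ks p → Linear Θ₂ →
  (cf₁ : CanonicalForm ks Θ₁) (cf₂ : CanonicalForm ks Θ₂) →
  ¬ u ≡ v → Before u v (word cf₁) → Before v u (word cf₂) →
  Σ Tm (λ C → OneHoleContext (shape ks p [ Nat /p]) Nat C
            × ([] ⊢ plug C (Θ₁ ⟦ Nat /p⟧) ≈ zero̲ ∶ Nat)
            × ([] ⊢ plug C (Θ₂ ⟦ Nat /p⟧) ≈ one̲ ∶ Nat))
separating-context {ks} {Θ₁} {Θ₂} {u} {v} D₁ L₁ D₂ L₂ cf₁ cf₂ u≢v u-before-v v-before-u =
  separator ks hole , (separator-typed ks (⊢hole (cong just (shape-⟦/p⟧ Nat ks))) , LC , holes-separator ks) ,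
  subst (λ w → [] ⊢ plug (separator ks hole) (Θ₁ ⟦ Nat /p⟧) ≈ encodeNat w ∶ Nat) g∘f
        (plug-separator-≈ ks Θ₁ D₁ L₁ LC cf₁) ,
  subst (λ w → [] ⊢ plug (separator ks hole) (Θ₂ ⟦ Nat /p⟧) ≈ encodeNat w ∶ Nat) f∘g
        (plug-separator-≈ ks Θ₂ D₂ L₂ LC cf₂)
  where
  open Separator u v
  u< = count-word-pos cf₁ u (Before⇒countˡ u-before-v)
  v< = count-word-pos cf₁ v (Before⇒countʳ u-before-v)
  LC = Linear-separator u≢v ks u< v<
  g∘f : run letter (word cf₁) [] ≡ false ∷ true ∷ []
  g∘f = trans (run-before letter letter-idle u≢v (word cf₁) u-before-v (count-word-< cf₁ u u<) (count-word-< cf₁ v v<) [])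
              (trans (cong (letter v) (letter-u [])) (letter-v u≢v _))
  f∘g : run letter (word cf₂) [] ≡ true ∷ false ∷ []
  f∘g = trans (run-before letter (λ x x≢v x≢u → letter-idle x x≢u x≢v) (≢-sym u≢v) (word cf₂) v-before-u
                          (count-word-< cf₂ v v<) (count-word-< cf₂ u u<) [])
              (trans (cong (letter u) (letter-v u≢v [])) (letter-u _))

theorem5p1 : (A : Ty) (Θ₁ Θ₂ : Tm) →
    ClosedNet A Θ₁ → ClosedNet A Θ₂ → order A < 4 →
    ¬ ([] ⊢ Θ₁ ≈ Θ₂ ∶ A) →
    Σ Tm (λ C → OneHoleContext (A [ Nat /p]) Nat C
      × ([] ⊢ plug C (Θ₁ ⟦ Nat /p⟧) ≈ zero̲ ∶ Nat)
      × ([] ⊢ plug C (Θ₂ ⟦ Nat /p⟧) ≈ one̲ ∶ Nat))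
theorem5p1 A Θ₁ Θ₂ (D₁ , L₁) (D₂ , L₂) order<4 Θ₁≉Θ₂ with order<4⇒shape A order<4
... | ks , refl with canonicalForm ks Θ₁ D₁ L₁ | canonicalForm ks Θ₂ D₂ L₂
...   | cf₁ | cf₂
  with inversion (word cf₁) (word cf₂) (same-counts cf₁ cf₂) (λ e → Θ₁≉Θ₂ (same-word⇒≈ cf₁ cf₂ e))
...     | u , v , u≢v , u-before-v , v-before-u = separating-context D₁ L₁ D₂ L₂ cf₁ cf₂ u≢v u-before-v v-before-u
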